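{- Let $G=(A\cup B,E)$ be a bipartite graph in which every node has a strict ranking of its neighbors, and let $M$ be a maximum matching in $G$. Then $M$ is a popular max-matching if and only if (1) there is no $M$-alternating cycle $C$ with $\mathsf{wt}_M(C)>0$, and (2) there is no $M$-alternating path $p$ having a node unmatched in $M$ as an endpoint with $\mathsf{wt}_M(p)>0$.
   Context: Node $u$ prefers matching $M$ to matching $N$ if either $u$ is matched in $M$ and unmatched in $N$, or $u$ is matched in both and prefers its partner in $M$ to its partner in $N$. Let $\phi(M,N)$ be the number of nodes preferring $M$ to $N$ and $\Delta(M,N)=\phi(M,N)-\phi(N,M)$. A maximum matching $M$ is a popular max-matching if $\Delta(M,N)\ge0$ for all maximum matchings $N$ of $G$. For a matching $M$, an edge $(a,b)$ blocks $M$ if each of $a,b$ is either unmatched in $M$ or prefers the other to its partner in $M$. Define $\mathsf{wt}_M:E\to\{0,\pm2\}$ by $\mathsf{wt}_M(a,b)=2$ if $(a,b)$ blocks $M$; $\mathsf{wt}_M(a,b)=-2$ if $a$ and $b$ both prefer their assignments in $M$ to each other; and $\mathsf{wt}_M(a,b)=0$ otherwise (so $\mathsf{wt}_M(e)=0$ for $e\in M$). For a path or cycle $\rho$, $\mathsf{wt}_M(\rho)=\sum_{e\in\rho}\mathsf{wt}_M(e)$. -}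

module Defs where

open import Data.Nat using (ℕ; zero; suc; _+_; _≤_; _<ᵇ_)
open import Data.Bool using (Bool; true; false; if_then_else_; _∧_)
open import Data.Fin using (Fin; zero; suc)
import Data.Fin as Fin
open import Data.Maybe using (Maybe; just; nothing; is-just)
open import Data.Sum using (_⊎_; inj₁; inj₂)
open import Data.Product using (_×_; _,_; proj₁; proj₂; Σ; ∃; uncurry)
open import Data.List using (List; []; _∷_; _++_; [_]; map; foldr; length; head; last)
open import Data.List.Relation.Unary.All using (All)
open import Data.List.Relation.Unary.Unique.Propositional using (Unique)
open import Data.Integer using (ℤ; +_; -_; 0ℤ) renaming (_+_ to _+ℤ_)
open import Relation.Binary.PropositionalEquality using (_≡_; _≢_)
open import Relation.Nullary.Decidable using (⌊_⌋)

-- Bipartite graph G = (A ∪ B, E) with A = Fin m, B = Fin n, and strict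
-- rankings: each node ranks its neighbours by a natural number
-- (smaller = more preferred), injective on its set of neighbours.

record Instance : Set where
  field
    m n    : ℕ
    E      : Fin m → Fin n → Bool
    rankA  : Fin m → Fin n → ℕ
    rankB  : Fin n → Fin m → ℕ
    strictA : ∀ a b b′ → E a b ≡ true → E a b′ ≡ true →
              rankA a b ≡ rankA a b′ → b ≡ b′
    strictB : ∀ b a a′ → E a b ≡ true → E a′ b ≡ true →
              rankB b a ≡ rankB b a′ → a ≡ a′

count : ∀ {k} → (Fin k → Bool) → ℕ
count {zero}  f = 0
count {suc k} f = (if f zero then 1 else 0) + count (λ i → f (suc i))

pref : {X : Set} → (X → ℕ) → Maybe X → Maybe X → Bool
pref r (just x) nothing  = true
pref r (just x) (just y) = r x <ᵇ r y
pref r nothing  _        = false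

isMate : ∀ {k} → Maybe (Fin k) → Fin k → Bool
isMate nothing  y = false
isMate (just x) y = ⌊ x Fin.≟ y ⌋

module _ (G : Instance) where
  open Instance G

  record Matching : Set where
    field
      mateA : Fin m → Maybe (Fin n)
      mateB : Fin n → Maybe (Fin m)
      consAB : ∀ a b → mateA a ≡ just b → mateB b ≡ just a
      consBA : ∀ a b → mateB b ≡ just a → mateA a ≡ just b
      inE    : ∀ a b → mateA a ≡ just b → E a b ≡ true
  open Matching public

  size : Matching → ℕ
  size M = count (λ a → is-just (mateA M a))

  IsMaximum : Matching → Set
  IsMaximum M = ∀ (N : Matching) → size N ≤ size M

  φ : Matching → Matching → ℕ
  φ M N = count (λ a → pref (rankA a) (mateA M a) (mateA N a))
        + count (λ b → pref (rankB b) (mateB M b) (mateB N b))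

  -- Δ(M,N) ≥ 0  ⇔  φ(N,M) ≤ φ(M,N)
  IsPopularMaxMatching : Matching → Set
  IsPopularMaxMatching M =
    IsMaximum M × (∀ (N : Matching) → IsMaximum N → φ N M ≤ φ M N)

  Node : Set
  Node = Fin m ⊎ Fin n

  adj : Node → Node → Bool
  adj (inj₁ a) (inj₂ b) = E a b
  adj (inj₂ b) (inj₁ a) = E a b
  adj _ _ = false

  inM : Matching → Node → Node → Bool
  inM M (inj₁ a) (inj₂ b) = isMate (mateA M a) b
  inM M (inj₂ b) (inj₁ a) = isMate (mateA M a) b
  inM M _ _ = false

  matched : Matching → Node → Bool
  matched M (inj₁ a) = is-just (mateA M a)
  matched M (inj₂ b) = is-just (mateB M b)

  wtAB : Matching → Fin m → Fin n → ℤ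
  wtAB M a b =
    if pref (rankA a) (just b) (mateA M a) ∧ pref (rankB b) (just a) (mateB M b)
    then + 2
    else (if pref (rankA a) (mateA M a) (just b) ∧ pref (rankB b) (mateB M b) (just a)
          then - (+ 2)
          else 0ℤ)

  wt : Matching → Node → Node → ℤ
  wt M (inj₁ a) (inj₂ b) = wtAB M a b
  wt M (inj₂ b) (inj₁ a) = wtAB M a b
  wt M _ _ = 0ℤ

pairs : {X : Set} → List X → List (X × X)
pairs (x ∷ y ∷ r) = (x , y) ∷ pairs (y ∷ r)
pairs _ = []

closeUp : {X : Set} → List X → List X
closeUp []       = []
closeUp (x ∷ xs) = x ∷ (xs ++ [ x ])

Alternates : List Bool → Set
Alternates bs = All (λ p → proj₁ p ≢ proj₂ p) (pairs bs)

sumℤ : List ℤ → ℤ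
sumℤ = foldr _+ℤ_ 0ℤ

module _ (G : Instance) (M : Matching G) where

  record IsAltPath (ps : List (Node G)) : Set where
    field
      nonTrivial : 2 ≤ length ps
      distinct   : Unique ps
      edges      : All (λ e → adj G (proj₁ e) (proj₂ e) ≡ true) (pairs ps)
      alternates : Alternates (map (uncurry (inM G M)) (pairs ps))

  HasUnmatchedEnd : List (Node G) → Set
  HasUnmatchedEnd ps =
    Σ (Node G) λ u → (head ps ≡ just u ⊎ last ps ≡ just u) × (matched G M u ≡ false)

  wtPath : List (Node G) → ℤ
  wtPath ps = sumℤ (map (uncurry (wt G M)) (pairs ps))

  -- M-alternating cycle v₀ … v_{k-1} v₀ (k ≥ 3 distinct nodes), alternation
  -- also across the closing edge (v_{k-1},v₀)–(v₀,v₁).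
  record IsAltCycle (cs : List (Node G)) : Set where
    field
      nonTrivial : 3 ≤ length cs
      distinct   : Unique cs
      edges      : All (λ e → adj G (proj₁ e) (proj₂ e) ≡ true) (pairs (closeUp cs))
      alternates : Alternates (closeUp (map (uncurry (inM G M)) (pairs (closeUp cs))))

  wtCycle : List (Node G) → ℤ
  wtCycle cs = sumℤ (map (uncurry (wt G M)) (pairs (closeUp cs)))

-- If N arises from M by switching along an M-alternating path or cycle ρ, then
-- Δ(N, M) = wt_M(ρ) minus the number of end edges of ρ in M: every vertex
-- votes only through its new edge, and wt_M(a, b) is the sum of the votes of a
-- and b for an edge (a, b) of N outside M.
--
-- Necessity: switching M along a positive cycle, or along a positive path with
-- a free end (prolonged by an M-edge if its other end is matched through an
-- edge outside M), yields a maximum matching N with Δ(N, M) > 0; for paths this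
-- uses that weights are even.
--
-- Sufficiency: for a maximum matching N, walking from a node where M and N
-- differ finds a path or cycle K of M ⊕ N. Let N″ follow N on K and M elsewhere,
-- and N′ follow M on K and N elsewhere. Both are maximum,
-- Δ(N, M) = Δ(N″, M) + Δ(N′, M), the first term is at most 0 by the two
-- conditions, and N′ disagrees with M on fewer nodes than N does.

module Submission where

open import Defs
open import Data.Bool using (Bool; true; false; not; if_then_else_; _∧_)
open import Data.Empty using (⊥; ⊥-elim)
open import Data.Fin using (Fin; zero; suc)
import Data.Fin.Properties as FinP
import Data.Bool.Properties as BoolP
open import Data.Integer using (ℤ; +_; -_; 0ℤ; 1ℤ; _+_; _-_; _<_; _≤_; -[1+_])
import Data.Integer as ℤ
import Data.Integer.Properties as ℤP
open import Data.Integer.Solver using (module +-*-Solver)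
open import Data.List using (List; []; _∷_; _++_; [_]; map; length; last; allFin)
import Data.List.Properties as ListP
open import Data.List.Membership.Propositional using (_∈_; _∉_; lose)
open import Data.List.Membership.Propositional.Properties using (∈-map⁺; ∈-map⁻; ∈-++⁺ˡ; ∈-++⁺ʳ; ∈-++⁻; ∈-allFin)
import Data.List.Membership.DecPropositional as DecMembership
open import Data.List.Relation.Unary.All as All using (All; []; _∷_)
open import Data.List.Relation.Unary.All.Properties using (¬Any⇒All¬)
import Data.List.Relation.Unary.All.Properties as AllP
open import Data.List.Relation.Unary.Any using (here; there; any?; satisfied)
open import Data.List.Relation.Unary.Unique.Propositional using (Unique)
open import Data.List.Relation.Unary.AllPairs as AllPairs using (AllPairs; []; _∷_)
open import Data.List.Relation.Unary.Unique.Propositional.Properties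
  using (Unique[x∷xs]⇒x∉xs; map⁺; ++⁺; allFin⁺)
open import Data.Maybe using (Maybe; just; nothing; is-just)
import Data.Maybe as Maybe
import Data.Maybe.Properties as MaybeP
import Data.Nat as ℕ
open ℕ using (ℕ; zero; suc)
import Data.Nat.Properties as ℕP
open import Data.Product using (_×_; _,_; proj₁; proj₂; Σ; ∃; uncurry)
open import Data.Sum using (_⊎_; inj₁; inj₂)
import Data.Sum as Sum
import Data.Sum.Properties as SumP
open import Function.Bundles using (_⇔_; mk⇔)
open import Algebra.Bundles using (AbelianGroup)
open import Algebra.Properties.Group (AbelianGroup.group ℤP.+-0-abelianGroup) using (∙-cancelʳ)
open import Relation.Binary.Definitions using (DecidableEquality)
open import Relation.Binary.PropositionalEquality
  using (_≡_; _≢_; refl; sym; trans; cong; cong₂; subst; subst₂; module ≡-Reasoning)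
open import Relation.Nullary using (¬_; Dec; yes; no; does)
open import Relation.Nullary.Decidable using (¬?; _×-dec_; _⊎-dec_; decidable-stable)

open +-*-Solver using (solve; _:+_; _:-_; _:=_; con)

-- Lists

∉⇒Unique∷ : {X : Set} {x : X} {xs : List X} → x ∉ xs → Unique xs → Unique (x ∷ xs)
∉⇒Unique∷ {xs = xs} x∉xs u = ¬Any⇒All¬ xs x∉xs ∷ u

Unique-snoc : {X : Set} {xs : List X} {w : X} → Unique xs → w ∉ xs → Unique (xs ++ [ w ])
Unique-snoc u w∉ = ++⁺ u ([] ∷ []) λ { (m , here refl) → w∉ m }

remove-∈ : {X : Set} {x : X} (ys : List X) → x ∈ ys →
           Σ (List X) λ ys′ → (length ys ≡ suc (length ys′)) × (∀ {z} → z ∈ ys → z ≢ x → z ∈ ys′)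
remove-∈ (y ∷ ys) (here refl) = ys , refl , λ { (here e) z≢x → ⊥-elim (z≢x e) ; (there m) _ → m }
remove-∈ (y ∷ ys) (there x∈) with remove-∈ ys x∈
... | ys′ , len , keep = y ∷ ys′ , cong suc len , λ { (here e) _ → here e ; (there m) z≢x → there (keep m z≢x) }

length-mono-Unique : {X : Set} (xs ys : List X) → Unique xs → (∀ {x} → x ∈ xs → x ∈ ys) → length xs ℕ.≤ length ys
length-mono-Unique [] ys u sub = ℕ.z≤n
length-mono-Unique (x ∷ xs) ys (x∉ ∷ u) sub with remove-∈ ys (sub (here refl))
... | ys′ , len , keep = subst (suc (length xs) ℕ.≤_) (sym len)
  (ℕ.s≤s (length-mono-Unique xs ys′ u λ {z} z∈ → keep (sub (there z∈)) λ { refl → All.lookup x∉ z∈ refl }))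

-- Integer sums over lists

∑ : {X : Set} → List X → (X → ℤ) → ℤ
∑ []       f = 0ℤ
∑ (x ∷ xs) f = f x + ∑ xs f

∑-++ : {X : Set} (xs ys : List X) (f : X → ℤ) → ∑ (xs ++ ys) f ≡ ∑ xs f + ∑ ys f
∑-++ []       ys f = sym (ℤP.+-identityˡ _)
∑-++ (x ∷ xs) ys f = trans (cong (_+_ (f x)) (∑-++ xs ys f)) (sym (ℤP.+-assoc (f x) _ _))

∑-map : {X Y : Set} (g : X → Y) (xs : List X) (f : Y → ℤ) → ∑ (map g xs) f ≡ ∑ xs (λ x → f (g x))
∑-map g []       f = refl
∑-map g (x ∷ xs) f = cong (_+_ (f (g x))) (∑-map g xs f)

sumℤ-map : {X : Set} (f : X → ℤ) (xs : List X) → sumℤ (map f xs) ≡ ∑ xs f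
sumℤ-map f []       = refl
sumℤ-map f (x ∷ xs) = cong (_+_ (f x)) (sumℤ-map f xs)

∑-cong : {X : Set} (xs : List X) {f g : X → ℤ} → (∀ {x} → x ∈ xs → f x ≡ g x) → ∑ xs f ≡ ∑ xs g
∑-cong []       eq = refl
∑-cong (x ∷ xs) eq = cong₂ _+_ (eq (here refl)) (∑-cong xs (λ m → eq (there m)))

∑-zero : {X : Set} (xs : List X) {f : X → ℤ} → (∀ {x} → x ∈ xs → f x ≡ 0ℤ) → ∑ xs f ≡ 0ℤ
∑-zero []       eq = refl
∑-zero (x ∷ xs) eq = cong₂ _+_ (eq (here refl)) (∑-zero xs (λ m → eq (there m)))

∑-distrib-+ : {X : Set} (xs : List X) (f g : X → ℤ) → ∑ xs (λ x → f x + g x) ≡ ∑ xs f + ∑ xs g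
∑-distrib-+ []       f g = refl
∑-distrib-+ (x ∷ xs) f g rewrite ∑-distrib-+ xs f g =
  solve 4 (λ a b c d → (a :+ b) :+ (c :+ d) := (a :+ c) :+ (b :+ d)) refl (f x) (g x) (∑ xs f) (∑ xs g)

∑-distrib-- : {X : Set} (xs : List X) (f g : X → ℤ) → ∑ xs (λ x → f x - g x) ≡ ∑ xs f - ∑ xs g
∑-distrib-- []       f g = refl
∑-distrib-- (x ∷ xs) f g rewrite ∑-distrib-- xs f g =
  solve 4 (λ a b c d → (a :- b) :+ (c :- d) := (a :+ c) :- (b :+ d)) refl (f x) (g x) (∑ xs f) (∑ xs g)

∑-mono-≤ : {X : Set} (xs : List X) {f g : X → ℤ} → (∀ x → f x ≤ g x) → ∑ xs f ≤ ∑ xs g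
∑-mono-≤ []       f≤g = ℤP.≤-refl
∑-mono-≤ (x ∷ xs) f≤g = ℤP.+-mono-≤ (f≤g x) (∑-mono-≤ xs f≤g)

∑-mono-<-at : {X : Set} (xs : List X) {f g : X → ℤ} → (∀ x → f x ≤ g x) → ∀ {x} → x ∈ xs → f x < g x → ∑ xs f < ∑ xs g
∑-mono-<-at (y ∷ xs) f≤g (here refl) f<g = ℤP.+-mono-<-≤ f<g (∑-mono-≤ xs f≤g)
∑-mono-<-at (y ∷ xs) f≤g (there m)   f<g = ℤP.+-mono-≤-< (f≤g y) (∑-mono-<-at xs f≤g m f<g)

∑-nonneg : {X : Set} (xs : List X) {f : X → ℤ} → (∀ x → 0ℤ ≤ f x) → 0ℤ ≤ ∑ xs f
∑-nonneg []       f≥0 = ℤP.≤-refl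
∑-nonneg (x ∷ xs) f≥0 = ℤP.+-mono-≤ (f≥0 x) (∑-nonneg xs f≥0)

module _ {X : Set} (_≟_ : DecidableEquality X) where

  private
    vanishAt : X → (X → ℤ) → X → ℤ
    vanishAt k f x with x ≟ k
    ... | yes _ = 0ℤ
    ... | no  _ = f x

    vanishAt-≢ : ∀ {k} f {x} → x ≢ k → vanishAt k f x ≡ f x
    vanishAt-≢ {k} f {x} x≢k with x ≟ k
    ... | yes x≡k = ⊥-elim (x≢k x≡k)
    ... | no  _   = refl

    ∑-split-at : (L : List X) (f : X → ℤ) {k : X} → Unique L → k ∈ L → ∑ L f ≡ f k + ∑ L (vanishAt k f)
    ∑-split-at (x ∷ L) f (x∉ ∷ u) (here refl) with x ≟ x
    ... | no x≢x = ⊥-elim (x≢x refl)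
    ... | yes _  = cong (_+_ (f x)) (trans (∑-cong L (λ m → sym (vanishAt-≢ f (λ { refl → All.lookup x∉ m refl }))))
                                         (sym (ℤP.+-identityˡ _)))
    ∑-split-at (x ∷ L) f {k} (x∉ ∷ u) (there k∈) = begin
      f x + ∑ L f                                 ≡⟨ cong (_+_ (f x)) (∑-split-at L f u k∈) ⟩
      f x + (f k + ∑ L (vanishAt k f))            ≡⟨ solve 3 (λ a b c → a :+ (b :+ c) := b :+ (a :+ c)) refl (f x) (f k) _ ⟩
      f k + (f x + ∑ L (vanishAt k f))            ≡⟨ cong (λ v → f k + (v + ∑ L (vanishAt k f))) (sym (vanishAt-≢ f x≢k)) ⟩
      f k + (vanishAt k f x + ∑ L (vanishAt k f)) ∎
      where
        open ≡-Reasoning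
        x≢k : x ≢ k
        x≢k refl = All.lookup x∉ k∈ refl

  ∑-restrict : (L K : List X) (f : X → ℤ) → Unique L → Unique K → (∀ {k} → k ∈ K → k ∈ L) →
               (∀ x → x ∉ K → f x ≡ 0ℤ) → ∑ L f ≡ ∑ K f
  ∑-restrict L []      f uL uK K⊆L f0 = ∑-zero L (λ {x} _ → f0 x λ ())
  ∑-restrict L (k ∷ K) f uL (k∉ ∷ uK) K⊆L f0 = begin
    ∑ L f                         ≡⟨ ∑-split-at L f uL (K⊆L (here refl)) ⟩
    f k + ∑ L (vanishAt k f)      ≡⟨ cong (_+_ (f k)) (∑-restrict L K (vanishAt k f) uL uK (λ m → K⊆L (there m)) f0′) ⟩
    f k + ∑ K (vanishAt k f)      ≡⟨ cong (_+_ (f k)) (∑-cong K (λ m → vanishAt-≢ f (λ { refl → All.lookup k∉ m refl }))) ⟩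
    f k + ∑ K f                   ∎
    where
      open ≡-Reasoning
      f0′ : ∀ x → x ∉ K → vanishAt k f x ≡ 0ℤ
      f0′ x x∉K with x ≟ k
      ... | yes _   = refl
      ... | no  x≢k = f0 x λ { (here x≡k) → x≢k x≡k ; (there m) → x∉K m }

lastOf : {X : Set} → X → List X → X
lastOf x []       = x
lastOf x (y ∷ ys) = lastOf y ys

lastPair : {X : Set} → X → X → List X → X × X
lastPair x y []      = x , y
lastPair x y (z ∷ r) = lastPair y z r

labels : {X : Set} → (X → X → Bool) → List X → List Bool
labels F L = map (uncurry F) (pairs L)

lastOf-∈ : {X : Set} (x : X) (xs : List X) → lastOf x xs ∈ x ∷ xs
lastOf-∈ x []       = here refl
lastOf-∈ x (y ∷ ys) = there (lastOf-∈ y ys)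

lastOf-snoc : {X : Set} (x : X) (xs : List X) (w : X) → lastOf x (xs ++ [ w ]) ≡ w
lastOf-snoc x []       w = refl
lastOf-snoc x (y ∷ ys) w = lastOf-snoc y ys w

lastOf≢head : {X : Set} {x y : X} {ys : List X} → Unique (x ∷ y ∷ ys) → lastOf y ys ≢ x
lastOf≢head {y = y} {ys} u eq = Unique[x∷xs]⇒x∉xs u (subst (_∈ y ∷ ys) eq (lastOf-∈ y ys))

proj₂-lastPair : {X : Set} (x y : X) (r : List X) → proj₂ (lastPair x y r) ≡ lastOf y r
proj₂-lastPair x y []      = refl
proj₂-lastPair x y (z ∷ r) = proj₂-lastPair y z r

lastPair-∈ : {X : Set} (x y : X) (r : List X) → lastPair x y r ∈ pairs (x ∷ y ∷ r)
lastPair-∈ x y []      = here refl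
lastPair-∈ x y (z ∷ r) = there (lastPair-∈ y z r)

last-lastPair : {X : Set} (x y : X) (r : List X) → last (x ∷ y ∷ r) ≡ just (proj₂ (lastPair x y r))
last-lastPair x y []      = refl
last-lastPair x y (z ∷ r) = last-lastPair y z r

lastPair-snoc : {X : Set} (x y : X) (r : List X) (w : X) → lastPair x y (r ++ [ w ]) ≡ (lastOf y r , w)
lastPair-snoc x y []      w = refl
lastPair-snoc x y (z ∷ r) w = lastPair-snoc y z r w

lastOf-labels : {X : Set} (F : X → X → Bool) (x y : X) (r : List X) →
                lastOf (F x y) (labels F (y ∷ r)) ≡ uncurry F (lastPair x y r)
lastOf-labels F x y []      = refl
lastOf-labels F x y (z ∷ r) = lastOf-labels F y z r

pairs-snoc : {X : Set} (x : X) (xs : List X) (w : X) → pairs (x ∷ xs ++ [ w ]) ≡ pairs (x ∷ xs) ++ [ (lastOf x xs , w) ]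
pairs-snoc x []       w = refl
pairs-snoc x (y ∷ ys) w = cong ((x , y) ∷_) (pairs-snoc y ys w)

∈-pairs-proj₁ : {X : Set} (L : List X) {e : X × X} → e ∈ pairs L → proj₁ e ∈ L
∈-pairs-proj₁ (x ∷ y ∷ L) (here refl) = here refl
∈-pairs-proj₁ (x ∷ y ∷ L) (there m)   = there (∈-pairs-proj₁ (y ∷ L) m)

∈-pairs-proj₂ : {X : Set} (x : X) (L : List X) {e : X × X} → e ∈ pairs (x ∷ L) → proj₂ e ∈ L
∈-pairs-proj₂ x (y ∷ L) (here refl) = here refl
∈-pairs-proj₂ x (y ∷ L) (there m)   = there (∈-pairs-proj₂ y L m)

∈-closeUp⁻ : {X : Set} (K : List X) {z : X} → z ∈ closeUp K → z ∈ K
∈-closeUp⁻ (x ∷ K) (here e)  = here e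
∈-closeUp⁻ (x ∷ K) (there m) with ∈-++⁻ K m
... | inj₁ m′        = there m′
... | inj₂ (here e) = here e

∈-closeUp⁺ : {X : Set} (K : List X) {z : X} → z ∈ K → z ∈ closeUp K
∈-closeUp⁺ (x ∷ K) (here e)  = here e
∈-closeUp⁺ (x ∷ K) (there m) = there (∈-++⁺ˡ m)

pair-at-head : {X : Set} {x y : X} {r : List X} → Unique (x ∷ y ∷ r) → {e : X × X} → e ∈ pairs (x ∷ y ∷ r) →
               (proj₁ e ≡ x ⊎ proj₂ e ≡ x) → e ≡ (x , y)
pair-at-head u (here refl) _ = refl
pair-at-head {y = y} {r} u (there m) (inj₁ refl) = ⊥-elim (Unique[x∷xs]⇒x∉xs u (∈-pairs-proj₁ (y ∷ r) m))
pair-at-head {y = y} {r} u (there m) (inj₂ refl) = ⊥-elim (Unique[x∷xs]⇒x∉xs u (there (∈-pairs-proj₂ y r m)))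

pair-at-last : {X : Set} {x y : X} {r : List X} → Unique (x ∷ y ∷ r) → {e : X × X} → e ∈ pairs (x ∷ y ∷ r) →
               (proj₁ e ≡ lastOf y r ⊎ proj₂ e ≡ lastOf y r) → e ≡ lastPair x y r
pair-at-last {r = []}    u (here refl) _ = refl
pair-at-last {r = z ∷ r} u (here refl) (inj₁ e) = ⊥-elim (Unique[x∷xs]⇒x∉xs u (there (subst (_∈ z ∷ r) (sym e) (lastOf-∈ z r))))
pair-at-last {r = z ∷ r} u (here refl) (inj₂ e) = ⊥-elim (lastOf≢head (AllPairs.tail u) (sym e))
pair-at-last {r = z ∷ r} u (there m) h = pair-at-last (AllPairs.tail u) m h

Alternates-tail : {b : Bool} {bs : List Bool} → Alternates (b ∷ bs) → Alternates bs
Alternates-tail {bs = []}    a       = []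
Alternates-tail {bs = c ∷ _} (_ ∷ a) = a

Alternates-snoc⁻ : (b : Bool) (bs : List Bool) {c : Bool} → Alternates (b ∷ bs ++ [ c ]) → Alternates (b ∷ bs) × lastOf b bs ≢ c
Alternates-snoc⁻ b bs {c} a with AllP.++⁻ (pairs (b ∷ bs)) (subst (All _) (pairs-snoc b bs c) a)
... | a′ , (l ∷ []) = a′ , l

Alternates-snoc⁺ : (b : Bool) (bs : List Bool) {c : Bool} → Alternates (b ∷ bs) → lastOf b bs ≢ c → Alternates (b ∷ bs ++ [ c ])
Alternates-snoc⁺ b bs {c} a l = subst (All _) (sym (pairs-snoc b bs c)) (AllP.++⁺ a (l ∷ []))

Alternates-map-not : (bs : List Bool) → Alternates bs → Alternates (map not bs)
Alternates-map-not []           a       = a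
Alternates-map-not (b ∷ [])     a       = a
Alternates-map-not (b ∷ c ∷ bs) (b≢c ∷ a) = (λ e → b≢c (BoolP.not-injective e)) ∷ Alternates-map-not (c ∷ bs) a

labels-not : {X : Set} (F : X → X → Bool) (L : List X) → labels (λ p q → not (F p q)) L ≡ map not (labels F L)
labels-not F L = ListP.map-∘ (pairs L)

labels-snoc : {X : Set} (F : X → X → Bool) (x : X) (xs : List X) (w : X) →
              labels F (x ∷ xs ++ [ w ]) ≡ labels F (x ∷ xs) ++ [ F (lastOf x xs) w ]
labels-snoc F x xs w = trans (cong (map (uncurry F)) (pairs-snoc x xs w)) (ListP.map-++ (uncurry F) (pairs (x ∷ xs)) _)

closeUp-map : {X Y : Set} (f : X → Y) (xs : List X) → closeUp (map f xs) ≡ map f (closeUp xs)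
closeUp-map f []       = refl
closeUp-map f (x ∷ xs) = cong (f x ∷_) (sym (ListP.map-++ f xs [ x ]))

-- Alternating sequences

⟦_⟧ : Bool → ℤ
⟦ true  ⟧ = 1ℤ
⟦ false ⟧ = 0ℤ

when : Bool → ℤ → ℤ
when b v = if b then v else 0ℤ

module _ {X : Set} (F : X → X → Bool) (V : X → ℤ) where

  unflaggedMass : X × X → ℤ
  unflaggedMass (p , q) = if F p q then 0ℤ else V p + V q

  -- Along an alternating path every vertex lies on exactly one unflagged
  -- pair, except an endpoint whose end pair is flagged.
  ∑-path-vertices : (x y : X) (r : List X) → Alternates (labels F (x ∷ y ∷ r)) →
    ∑ (x ∷ y ∷ r) V ≡ (∑ (pairs (x ∷ y ∷ r)) unflaggedMass + when (F x y) (V x))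
                      + when (uncurry F (lastPair x y r)) (V (proj₂ (lastPair x y r)))
  ∑-path-vertices x y [] _ with F x y
  ... | true  = solve 2 (λ a b → a :+ (b :+ con 0ℤ) := ((con 0ℤ :+ con 0ℤ) :+ a) :+ b) refl (V x) (V y)
  ... | false = solve 2 (λ a b → a :+ (b :+ con 0ℤ) := (((a :+ b) :+ con 0ℤ) :+ con 0ℤ) :+ con 0ℤ) refl (V x) (V y)
  ∑-path-vertices x y (z ∷ r) (ne ∷ alt) rewrite ∑-path-vertices y z r alt = step (F x y) (F y z) ne
    where
      S = ∑ (pairs (y ∷ z ∷ r)) unflaggedMass
      E = when (uncurry F (lastPair y z r)) (V (proj₂ (lastPair y z r)))
      step : ∀ a b → a ≢ b → V x + ((S + when b (V y)) + E) ≡ (((if a then 0ℤ else V x + V y) + S) + when a (V x)) + E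
      step true  true  ne = ⊥-elim (ne refl)
      step false false ne = ⊥-elim (ne refl)
      step true  false ne = solve 3 (λ a s e → a :+ ((s :+ con 0ℤ) :+ e) := ((con 0ℤ :+ s) :+ a) :+ e) refl (V x) S E
      step false true  ne = solve 4 (λ a b s e → a :+ ((s :+ b) :+ e) := (((a :+ b) :+ s) :+ con 0ℤ) :+ e) refl (V x) (V y) S E

  ∑-cycle-vertices : (x y : X) (r : List X) → Alternates (closeUp (labels F (closeUp (x ∷ y ∷ r)))) →
    ∑ (x ∷ y ∷ r) V ≡ ∑ (pairs (closeUp (x ∷ y ∷ r))) unflaggedMass
  ∑-cycle-vertices x y r alt = ∙-cancelʳ (V x) _ _ (begin
    ∑ (x ∷ y ∷ r) V + V x                                         ≡⟨ cong (_+_ (∑ (x ∷ y ∷ r) V)) (sym (ℤP.+-identityʳ (V x))) ⟩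
    ∑ (x ∷ y ∷ r) V + ∑ [ x ] V                                   ≡⟨ sym (∑-++ (x ∷ y ∷ r) [ x ] V) ⟩
    ∑ (x ∷ y ∷ r ++ [ x ]) V                                      ≡⟨ ∑-path-vertices x y (r ++ [ x ]) path-alt ⟩
    (S + when (F x y) (V x)) + when (uncurry F (lastPair x y (r ++ [ x ]))) (V (proj₂ (lastPair x y (r ++ [ x ]))))
                                                                  ≡⟨ cong (λ e → (S + when (F x y) (V x)) + when (uncurry F e) (V (proj₂ e)))
                                                                          (lastPair-snoc x y r x) ⟩
    (S + when (F x y) (V x)) + when (F (lastOf y r) x) (V x)      ≡⟨ ℤP.+-assoc S _ _ ⟩
    S + (when (F x y) (V x) + when (F (lastOf y r) x) (V x))      ≡⟨ cong (_+_ S) (ends (F x y) (F (lastOf y r) x) ends-differ) ⟩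
    S + V x                                                       ∎)
    where
      open ≡-Reasoning
      S = ∑ (pairs (closeUp (x ∷ y ∷ r))) unflaggedMass
      closed = Alternates-snoc⁻ (F x y) (labels F (y ∷ r ++ [ x ])) alt
      path-alt = proj₁ closed
      ends-differ : F x y ≢ F (lastOf y r) x
      ends-differ e = proj₂ closed (trans (lastOf-labels F x y (r ++ [ x ]))
                                   (trans (cong (uncurry F) (lastPair-snoc x y r x)) (sym e)))
      ends : ∀ a b → a ≢ b → when a (V x) + when b (V x) ≡ V x
      ends true  true  ne = ⊥-elim (ne refl)
      ends false false ne = ⊥-elim (ne refl)
      ends true  false ne = ℤP.+-identityʳ (V x)
      ends false true  ne = ℤP.+-identityˡ (V x)

unflagged−flagged : Bool → ℤ
unflagged−flagged b = ⟦ not b ⟧ - ⟦ b ⟧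

∑-alternating : (b : Bool) (bs : List Bool) → Alternates (b ∷ bs) →
  ∑ (b ∷ bs) unflagged−flagged ≡ (⟦ not b ⟧ + ⟦ not (lastOf b bs) ⟧) - 1ℤ
∑-alternating true  []       _ = refl
∑-alternating false []       _ = refl
∑-alternating b     (c ∷ cs) (ne ∷ alt) rewrite ∑-alternating c cs alt = step b c ne (⟦ not (lastOf c cs) ⟧)
  where
    step : ∀ b c → b ≢ c → (l : ℤ) → unflagged−flagged b + ((⟦ not c ⟧ + l) - 1ℤ) ≡ (⟦ not b ⟧ + l) - 1ℤ
    step true  true  ne = ⊥-elim (ne refl)
    step false false ne = ⊥-elim (ne refl)
    step true  false ne l = solve 1 (λ l → (con 0ℤ :- con 1ℤ) :+ ((con 1ℤ :+ l) :- con 1ℤ) := (con 0ℤ :+ l) :- con 1ℤ) refl l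
    step false true  ne l = solve 1 (λ l → (con 1ℤ :- con 0ℤ) :+ ((con 0ℤ :+ l) :- con 1ℤ) := (con 1ℤ :+ l) :- con 1ℤ) refl l

∑-alternating-closed : (b : Bool) (bs : List Bool) → Alternates (closeUp (b ∷ bs)) → ∑ (b ∷ bs) unflagged−flagged ≡ 0ℤ
∑-alternating-closed b bs alt with Alternates-snoc⁻ b bs alt
... | alt′ , last≢b = trans (∑-alternating b bs alt′) (ends (lastOf b bs) b last≢b)
  where
    ends : ∀ a b → a ≢ b → (⟦ not b ⟧ + ⟦ not a ⟧) - 1ℤ ≡ 0ℤ
    ends true  true  ne = ⊥-elim (ne refl)
    ends false false ne = ⊥-elim (ne refl)
    ends true  false ne = refl
    ends false true  ne = refl

-- Preferences and votes

n<ᵇn≡false : ∀ n → (n ℕ.<ᵇ n) ≡ false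
n<ᵇn≡false zero    = refl
n<ᵇn≡false (suc n) = n<ᵇn≡false n

<ᵇ-flip : ∀ i j → i ≢ j → (j ℕ.<ᵇ i) ≡ not (i ℕ.<ᵇ j)
<ᵇ-flip zero    zero    i≢j = ⊥-elim (i≢j refl)
<ᵇ-flip zero    (suc j) i≢j = refl
<ᵇ-flip (suc i) zero    i≢j = refl
<ᵇ-flip (suc i) (suc j) i≢j = <ᵇ-flip i j (λ e → i≢j (cong suc e))

pref-irrefl : {X : Set} (r : X → ℕ) (u : Maybe X) → pref r u u ≡ false
pref-irrefl r (just x) = n<ᵇn≡false (r x)
pref-irrefl r nothing  = refl

pref-map : {X Y : Set} (r : Y → ℕ) (g : X → Y) (u v : Maybe X) →
           pref (λ x → r (g x)) u v ≡ pref r (Maybe.map g u) (Maybe.map g v)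
pref-map r g (just x) (just y) = refl
pref-map r g (just x) nothing  = refl
pref-map r g nothing  (just y) = refl
pref-map r g nothing  nothing  = refl

count-as-∑ : ∀ {k} (f : Fin k → Bool) → + count f ≡ ∑ (allFin k) (λ i → ⟦ f i ⟧)
count-as-∑ {zero}  f = refl
count-as-∑ {suc k} f = trans (ℤP.pos-+ _ (count (λ i → f (suc i))))
  (cong₂ _+_ (indicator (f zero))
             (trans (count-as-∑ (λ i → f (suc i)))
                    (trans (sym (∑-map suc (allFin k) (λ i → ⟦ f i ⟧)))
                           (cong (λ l → ∑ l (λ i → ⟦ f i ⟧)) (ListP.map-tabulate (λ i → i) suc)))))
  where
    indicator : ∀ b → + (if b then 1 else 0) ≡ ⟦ b ⟧
    indicator true  = refl
    indicator false = refl

module Matchings (G : Instance) where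
  open Instance G

  _≟ₙ_ : DecidableEquality (Node G)
  _≟ₙ_ = SumP.≡-dec FinP._≟_ FinP._≟_

  mate : Matching G → Node G → Maybe (Node G)
  mate M (inj₁ a) = Maybe.map inj₂ (mateA M a)
  mate M (inj₂ b) = Maybe.map inj₁ (mateB M b)

  mate-sym : (M : Matching G) {x y : Node G} → mate M x ≡ just y → mate M y ≡ just x
  mate-sym M {inj₁ a} e with mateA M a in eq
  mate-sym M {inj₁ a} refl | just b rewrite consAB M a b eq = refl
  mate-sym M {inj₂ b} e with mateB M b in eq
  mate-sym M {inj₂ b} refl | just a rewrite consBA M a b eq = refl

  mate-adj : (M : Matching G) {x y : Node G} → mate M x ≡ just y → adj G x y ≡ true
  mate-adj M {inj₁ a} e with mateA M a in eq
  mate-adj M {inj₁ a} refl | just b = inE M a b eq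
  mate-adj M {inj₂ b} e with mateB M b in eq
  mate-adj M {inj₂ b} refl | just a = inE M a b (consBA M a b eq)

  adj-irrefl : ∀ x → adj G x x ≡ false
  adj-irrefl (inj₁ a) = refl
  adj-irrefl (inj₂ b) = refl

  adj-sym : ∀ x y → adj G x y ≡ adj G y x
  adj-sym (inj₁ a) (inj₂ b)  = refl
  adj-sym (inj₂ b) (inj₁ a)  = refl
  adj-sym (inj₁ a) (inj₁ a′) = refl
  adj-sym (inj₂ b) (inj₂ b′) = refl

  mate-irrefl : (M : Matching G) (x : Node G) → mate M x ≢ just x
  mate-irrefl M x e with trans (sym (adj-irrefl x)) (mate-adj M {x} e)
  ... | ()

  private
    isMate⇒≡ : ∀ {k} (u : Maybe (Fin k)) (y : Fin k) → isMate u y ≡ true → u ≡ just y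
    isMate⇒≡ (just x) y e with x FinP.≟ y
    isMate⇒≡ (just x) y e  | yes refl = refl
    isMate⇒≡ (just x) y () | no _
    isMate⇒≡ nothing  y ()

    isMate-refl : ∀ {k} (y : Fin k) → isMate (just y) y ≡ true
    isMate-refl y with y FinP.≟ y
    ... | yes _   = refl
    ... | no  y≢y = ⊥-elim (y≢y refl)

  inM⇒mate : (M : Matching G) (x y : Node G) → inM G M x y ≡ true → mate M x ≡ just y
  inM⇒mate M (inj₁ a) (inj₂ b)  e rewrite isMate⇒≡ (mateA M a) b e = refl
  inM⇒mate M (inj₂ b) (inj₁ a)  e rewrite consAB M a b (isMate⇒≡ (mateA M a) b e) = refl
  inM⇒mate M (inj₁ a) (inj₁ a′) ()
  inM⇒mate M (inj₂ b) (inj₂ b′) ()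

  mate⇒inM : (M : Matching G) (x y : Node G) → mate M x ≡ just y → inM G M x y ≡ true
  mate⇒inM M (inj₁ a) y e with mateA M a in eq
  mate⇒inM M (inj₁ a) .(inj₂ b) refl | just b rewrite eq = isMate-refl b
  mate⇒inM M (inj₂ b) y e with mateB M b in eq
  mate⇒inM M (inj₂ b) .(inj₁ a) refl | just a rewrite consBA M a b eq = isMate-refl b

  ¬inM⇒≢mate : (M : Matching G) (x y : Node G) → inM G M x y ≡ false → mate M x ≢ just y
  ¬inM⇒≢mate M x y f e with trans (sym f) (mate⇒inM M x y e)
  ... | ()

  inM-sym : (M : Matching G) (x y : Node G) → inM G M x y ≡ inM G M y x
  inM-sym M x y with inM G M x y in e₁ | inM G M y x in e₂
  ... | true  | true  = refl
  ... | false | false = refl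
  ... | true  | false = ⊥-elim (¬inM⇒≢mate M y x e₂ (mate-sym M {x} (inM⇒mate M x y e₁)))
  ... | false | true  = ⊥-elim (¬inM⇒≢mate M x y e₁ (mate-sym M {y} (inM⇒mate M y x e₂)))

  unmatched⇒mate≡nothing : (M : Matching G) (u : Node G) → matched G M u ≡ false → mate M u ≡ nothing
  unmatched⇒mate≡nothing M (inj₁ a) e with mateA M a
  ... | nothing = refl
  unmatched⇒mate≡nothing M (inj₂ b) e with mateB M b
  ... | nothing = refl

  mate≡nothing⇒unmatched : (M : Matching G) (u : Node G) → mate M u ≡ nothing → matched G M u ≡ false
  mate≡nothing⇒unmatched M (inj₁ a) e with mateA M a
  ... | nothing = refl
  mate≡nothing⇒unmatched M (inj₂ b) e with mateB M b
  ... | nothing = refl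

  rank : Node G → Node G → ℕ
  rank (inj₁ a) (inj₂ b) = rankA a b
  rank (inj₂ b) (inj₁ a) = rankB b a
  rank _        _        = 0

  prefers : Matching G → Matching G → Node G → Bool
  prefers M N x = pref (rank x) (mate M x) (mate N x)

  vote : Matching G → Matching G → Node G → ℤ
  vote N M x = ⟦ prefers N M x ⟧ - ⟦ prefers M N x ⟧

  vote-cong : {N N′ M M′ : Matching G} (x : Node G) → mate N x ≡ mate N′ x → mate M x ≡ mate M′ x → vote N M x ≡ vote N′ M′ x
  vote-cong x e₁ e₂ = cong₂ (λ u v → ⟦ pref (rank x) u v ⟧ - ⟦ pref (rank x) v u ⟧) e₁ e₂

  vote-same : (N M : Matching G) (x : Node G) → mate N x ≡ mate M x → vote N M x ≡ 0ℤ
  vote-same N M x e rewrite e | pref-irrefl (rank x) (mate M x) = refl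

  -- x's contribution to size M: only the A-side is counted
  matchedA : Matching G → Node G → ℤ
  matchedA M (inj₁ a) = ⟦ is-just (mate M (inj₁ a)) ⟧
  matchedA M (inj₂ b) = 0ℤ

  matchedA-cong : {N M : Matching G} (x : Node G) → mate N x ≡ mate M x → matchedA N x ≡ matchedA M x
  matchedA-cong (inj₁ a) e = cong (λ u → ⟦ is-just u ⟧) e
  matchedA-cong (inj₂ b) e = refl

  matchedA-unmatched : (N : Matching G) (x : Node G) → mate N x ≡ nothing → matchedA N x ≡ 0ℤ
  matchedA-unmatched N (inj₁ a) e rewrite e = refl
  matchedA-unmatched N (inj₂ b) e = refl

  matchedA-edge : (N : Matching G) (x y : Node G) → mate N x ≡ just y → matchedA N x + matchedA N y ≡ 1ℤ
  matchedA-edge N (inj₁ a) (inj₂ b) e rewrite e = refl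
  matchedA-edge N (inj₂ b) (inj₁ a) e rewrite mate-sym N {inj₂ b} {inj₁ a} e = refl
  matchedA-edge N (inj₁ a) (inj₁ a′) e with mate-adj N {inj₁ a} e
  ... | ()
  matchedA-edge N (inj₂ b) (inj₂ b′) e with mate-adj N {inj₂ b} e
  ... | ()

  allNodes : List (Node G)
  allNodes = map inj₁ (allFin m) ++ map inj₂ (allFin n)

  ∈-allNodes : (x : Node G) → x ∈ allNodes
  ∈-allNodes (inj₁ a) = ∈-++⁺ˡ (∈-map⁺ inj₁ (∈-allFin a))
  ∈-allNodes (inj₂ b) = ∈-++⁺ʳ (map inj₁ (allFin m)) (∈-map⁺ inj₂ (∈-allFin b))

  Unique-allNodes : Unique allNodes
  Unique-allNodes = ++⁺ (map⁺ SumP.inj₁-injective (allFin⁺ m)) (map⁺ SumP.inj₂-injective (allFin⁺ n)) disjoint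
    where
      disjoint : ∀ {x} → x ∈ map inj₁ (allFin m) × x ∈ map inj₂ (allFin n) → ⊥
      disjoint (m₁ , m₂) with ∈-map⁻ inj₁ m₁ | ∈-map⁻ inj₂ m₂
      ... | _ , _ , refl | _ , _ , ()

  ∑-allNodes : (h : Node G → ℤ) → ∑ allNodes h ≡ ∑ (allFin m) (λ a → h (inj₁ a)) + ∑ (allFin n) (λ b → h (inj₂ b))
  ∑-allNodes h = trans (∑-++ (map inj₁ (allFin m)) _ h) (cong₂ _+_ (∑-map inj₁ (allFin m) h) (∑-map inj₂ (allFin n) h))

  φ-as-∑ : (M N : Matching G) → + φ G M N ≡ ∑ allNodes (λ x → ⟦ prefers M N x ⟧)
  φ-as-∑ M N = begin
    + φ G M N
      ≡⟨ ℤP.pos-+ (count (λ a → pref (rankA a) (mateA M a) (mateA N a))) (count (λ b → pref (rankB b) (mateB M b) (mateB N b))) ⟩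
    + count (λ a → pref (rankA a) (mateA M a) (mateA N a)) + + count (λ b → pref (rankB b) (mateB M b) (mateB N b))
      ≡⟨ cong₂ _+_ (count-as-∑ (λ a → pref (rankA a) (mateA M a) (mateA N a)))
                   (count-as-∑ (λ b → pref (rankB b) (mateB M b) (mateB N b))) ⟩
    _ ≡⟨ cong₂ _+_ (∑-cong (allFin m) (λ {a} _ → cong ⟦_⟧ (pref-map (rank (inj₁ a)) inj₂ (mateA M a) (mateA N a))))
                   (∑-cong (allFin n) (λ {b} _ → cong ⟦_⟧ (pref-map (rank (inj₂ b)) inj₁ (mateB M b) (mateB N b)))) ⟩
    _ ≡⟨ sym (∑-allNodes _) ⟩
    ∑ allNodes (λ x → ⟦ prefers M N x ⟧) ∎
    where open ≡-Reasoning

  Δ : Matching G → Matching G → ℤ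
  Δ N M = + φ G N M - + φ G M N

  Δ-as-∑ : (N M : Matching G) → Δ N M ≡ ∑ allNodes (vote N M)
  Δ-as-∑ N M = trans (cong₂ _-_ (φ-as-∑ N M) (φ-as-∑ M N)) (sym (∑-distrib-- allNodes _ _))

  size-as-∑ : (M : Matching G) → + size G M ≡ ∑ allNodes (matchedA M)
  size-as-∑ M = begin
    + size G M                                                            ≡⟨ count-as-∑ (λ a → is-just (mateA M a)) ⟩
    ∑ (allFin m) (λ a → ⟦ is-just (mateA M a) ⟧)                          ≡⟨ ∑-cong (allFin m) (λ {a} _ → cong ⟦_⟧ (is-just-map (mateA M a))) ⟩
    ∑ (allFin m) (λ a → matchedA M (inj₁ a))                              ≡⟨ sym (ℤP.+-identityʳ _) ⟩
    ∑ (allFin m) (λ a → matchedA M (inj₁ a)) + 0ℤ                         ≡⟨ cong (_+_ (∑ (allFin m) (λ a → matchedA M (inj₁ a)))) (sym (∑-zero (allFin n) {λ _ → 0ℤ} (λ _ → refl))) ⟩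
    ∑ (allFin m) (λ a → matchedA M (inj₁ a)) + ∑ (allFin n) (λ _ → 0ℤ)    ≡⟨ sym (∑-allNodes (matchedA M)) ⟩
    ∑ allNodes (matchedA M)                                               ∎
    where
      open ≡-Reasoning
      is-just-map : (u : Maybe (Fin n)) → is-just u ≡ is-just (Maybe.map (inj₂ {A = Fin m}) u)
      is-just-map (just _) = refl
      is-just-map nothing  = refl

  size-diff-as-∑ : (N M : Matching G) → + size G N - + size G M ≡ ∑ allNodes (λ x → matchedA N x - matchedA M x)
  size-diff-as-∑ N M = trans (cong₂ _-_ (size-as-∑ N) (size-as-∑ M)) (sym (∑-distrib-- allNodes _ _))

  rank-injective : ∀ x y y′ → adj G x y ≡ true → adj G x y′ ≡ true → rank x y ≡ rank x y′ → y ≡ y′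
  rank-injective (inj₁ a) (inj₂ b) (inj₂ b′) e e′ r = cong inj₂ (strictA a b b′ e e′ r)
  rank-injective (inj₂ b) (inj₁ a) (inj₁ a′) e e′ r = cong inj₁ (strictB b a a′ e e′ r)
  rank-injective (inj₁ a) (inj₁ _) _ ()
  rank-injective (inj₂ b) (inj₂ _) _ ()
  rank-injective (inj₁ a) (inj₂ _) (inj₁ _) _ ()
  rank-injective (inj₂ b) (inj₁ _) (inj₂ _) _ ()

  prefers-edge prefers-mate : Matching G → Node G → Node G → Bool
  prefers-edge M x y = pref (rank x) (just y) (mate M x)
  prefers-mate M x y = pref (rank x) (mate M x) (just y)

  prefers-mate-complement : (M : Matching G) (x y : Node G) → adj G x y ≡ true → mate M x ≢ just y →
                            prefers-mate M x y ≡ not (prefers-edge M x y)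
  prefers-mate-complement M x y xy x≢y with mate M x in eq
  ... | nothing = refl
  ... | just y′ = <ᵇ-flip (rank x y) (rank x y′) λ r → x≢y (cong just (sym (rank-injective x y y′ xy (mate-adj M {x} eq) r)))

  wt-as-prefers : (M : Matching G) (x y : Node G) → adj G x y ≡ true →
    wt G M x y ≡ (if prefers-edge M x y ∧ prefers-edge M y x then + 2
                  else if prefers-mate M x y ∧ prefers-mate M y x then - (+ 2) else 0ℤ)
  wt-as-prefers M (inj₁ a) (inj₂ b) _
    rewrite pref-map (rank (inj₁ a)) inj₂ (just b) (mateA M a) | pref-map (rank (inj₁ a)) inj₂ (mateA M a) (just b)
          | pref-map (rank (inj₂ b)) inj₁ (just a) (mateB M b) | pref-map (rank (inj₂ b)) inj₁ (mateB M b) (just a) = refl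
  wt-as-prefers M (inj₂ b) (inj₁ a) _
    rewrite pref-map (rank (inj₁ a)) inj₂ (just b) (mateA M a) | pref-map (rank (inj₁ a)) inj₂ (mateA M a) (just b)
          | pref-map (rank (inj₂ b)) inj₁ (just a) (mateB M b) | pref-map (rank (inj₂ b)) inj₁ (mateB M b) (just a)
          = ∧-swap (prefers-edge M (inj₁ a) (inj₂ b)) (prefers-edge M (inj₂ b) (inj₁ a))
                   (prefers-mate M (inj₁ a) (inj₂ b)) (prefers-mate M (inj₂ b) (inj₁ a))
    where
      ∧-swap : ∀ p q p′ q′ → (if p ∧ q then + 2 else if p′ ∧ q′ then - (+ 2) else 0ℤ)
                           ≡ (if q ∧ p then + 2 else if q′ ∧ p′ then - (+ 2) else 0ℤ)
      ∧-swap p q p′ q′ rewrite BoolP.∧-comm p q | BoolP.∧-comm p′ q′ = refl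

  vote-new-edge : (N M : Matching G) (x y : Node G) → mate N x ≡ just y → mate M x ≢ just y →
                  vote N M x + vote N M y ≡ wt G M x y
  vote-new-edge N M x y Nxy x≢y = begin
    vote N M x + vote N M y
      ≡⟨ cong₂ _+_ (vote-on x y Nxy x≢y xy) (vote-on y x (mate-sym N {x} Nxy) y≢x yx) ⟩
    (⟦ p ⟧ - ⟦ not p ⟧) + (⟦ q ⟧ - ⟦ not q ⟧)
      ≡⟨ votes p q ⟩
    (if p ∧ q then + 2 else if not p ∧ not q then - (+ 2) else 0ℤ)
      ≡⟨ sym (cong₂ (λ u v → if p ∧ q then + 2 else if u ∧ v then - (+ 2) else 0ℤ)
                    (prefers-mate-complement M x y xy x≢y) (prefers-mate-complement M y x yx y≢x)) ⟩
    _ ≡⟨ sym (wt-as-prefers M x y xy) ⟩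
    wt G M x y ∎
    where
      open ≡-Reasoning
      p = prefers-edge M x y
      q = prefers-edge M y x
      xy = mate-adj N {x} Nxy
      yx = mate-adj N {y} (mate-sym N {x} Nxy)
      y≢x : mate M y ≢ just x
      y≢x e = x≢y (mate-sym M {y} e)
      vote-on : ∀ u v → mate N u ≡ just v → mate M u ≢ just v → adj G u v ≡ true →
                vote N M u ≡ ⟦ prefers-edge M u v ⟧ - ⟦ not (prefers-edge M u v) ⟧
      vote-on u v Nuv u≢v uv rewrite Nuv = cong (λ b → ⟦ prefers-edge M u v ⟧ - ⟦ b ⟧) (prefers-mate-complement M u v uv u≢v)
      votes : ∀ p q → (⟦ p ⟧ - ⟦ not p ⟧) + (⟦ q ⟧ - ⟦ not q ⟧)
                      ≡ (if p ∧ q then + 2 else if not p ∧ not q then - (+ 2) else 0ℤ)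
      votes true  true  = refl
      votes true  false = refl
      votes false true  = refl
      votes false false = refl

  wt-matched-edge : (M : Matching G) (x y : Node G) → inM G M x y ≡ true → wt G M x y ≡ 0ℤ
  wt-matched-edge M x y xy
    rewrite wt-as-prefers M x y (mate-adj M {x} (inM⇒mate M x y xy)) | inM⇒mate M x y xy
          | n<ᵇn≡false (rank x y) = refl

module Switching (G : Instance) (M N : Matching G) where
  open Matchings G

  SwitchedEdge : Node G × Node G → Set
  SwitchedEdge (p , q) = (adj G p q ≡ true) × (inM G M p q ≡ false → mate N p ≡ just q)

  -- the condition at an end z whose end pair is (b = true) or is not (b = false) in M
  SwitchedEnd : Bool → Node G → Set
  SwitchedEnd true  z = mate N z ≡ nothing
  SwitchedEnd false z = mate M z ≡ nothing

  record SwitchedPath (x y : Node G) (r : List (Node G)) : Set where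
    field
      distinct   : Unique (x ∷ y ∷ r)
      alternates : Alternates (labels (inM G M) (x ∷ y ∷ r))
      edges      : All SwitchedEdge (pairs (x ∷ y ∷ r))
      agreeOff   : ∀ z → z ∉ x ∷ y ∷ r → mate N z ≡ mate M z
      headEnd    : SwitchedEnd (inM G M x y) x
      lastEnd    : SwitchedEnd (uncurry (inM G M) (lastPair x y r)) (proj₂ (lastPair x y r))

  record SwitchedCycle (x y : Node G) (r : List (Node G)) : Set where
    field
      distinct   : Unique (x ∷ y ∷ r)
      alternates : Alternates (closeUp (labels (inM G M) (closeUp (x ∷ y ∷ r))))
      edges      : All SwitchedEdge (pairs (closeUp (x ∷ y ∷ r)))
      agreeOff   : ∀ z → z ∉ x ∷ y ∷ r → mate N z ≡ mate M z

  private
    -- |M| is counted along the pairs of M, which are the unflagged ones for notInM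
    notInM : Node G → Node G → Bool
    notInM p q = not (inM G M p q)

    mass-vote : ∀ e → SwitchedEdge e → unflaggedMass (inM G M) (vote N M) e ≡ uncurry (wt G M) e
    mass-vote (p , q) (_ , new) with inM G M p q in pq
    ... | true  = sym (wt-matched-edge M p q pq)
    ... | false = vote-new-edge N M p q (new refl) (¬inM⇒≢mate M p q pq)

    mass-size-N : ∀ e → SwitchedEdge e → unflaggedMass (inM G M) (matchedA N) e ≡ ⟦ not (uncurry (inM G M) e) ⟧
    mass-size-N (p , q) (_ , new) with inM G M p q in pq
    ... | true  = refl
    ... | false = matchedA-edge N p q (new refl)

    mass-size-M : ∀ e → SwitchedEdge e → unflaggedMass notInM (matchedA M) e ≡ ⟦ uncurry (inM G M) e ⟧
    mass-size-M (p , q) _ with inM G M p q in pq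
    ... | true  = matchedA-edge M p q (inM⇒mate M p q pq)
    ... | false = refl

    end-vote : ∀ z w → SwitchedEnd (inM G M z w) z → when (inM G M z w) (vote N M z) ≡ - ⟦ inM G M z w ⟧
    end-vote z w end with inM G M z w in zw
    ... | false = refl
    ... | true rewrite end | inM⇒mate M z w zw = refl

    end-size-N : ∀ b z → SwitchedEnd b z → when b (matchedA N z) ≡ 0ℤ
    end-size-N true  z end = matchedA-unmatched N z end
    end-size-N false z end = refl

    end-size-M : ∀ b z → SwitchedEnd b z → when (not b) (matchedA M z) ≡ 0ℤ
    end-size-M true  z end = refl
    end-size-M false z end = matchedA-unmatched M z end

    ∑-over-switch : (L : List (Node G)) → Unique L → (∀ z → z ∉ L → mate N z ≡ mate M z) →
                    (Δ N M ≡ ∑ L (vote N M)) × (+ size G N - + size G M ≡ ∑ L (matchedA N) - ∑ L (matchedA M))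
    ∑-over-switch L u off =
      trans (Δ-as-∑ N M) (∑-restrict _≟ₙ_ allNodes L _ Unique-allNodes u (λ _ → ∈-allNodes _) λ z z∉ → vote-same N M z (off z z∉)) ,
      trans (size-diff-as-∑ N M)
        (trans (∑-restrict _≟ₙ_ allNodes L _ Unique-allNodes u (λ _ → ∈-allNodes _)
                  λ z z∉ → trans (cong (_- matchedA M z) (matchedA-cong z (off z z∉))) (ℤP.+-inverseʳ (matchedA M z)))
               (∑-distrib-- L (matchedA N) (matchedA M)))

    ∑-mass : {f g : Node G × Node G → ℤ} (es : List (Node G × Node G)) → All SwitchedEdge es →
             (∀ e → SwitchedEdge e → f e ≡ g e) → ∑ es f ≡ ∑ es g
    ∑-mass es ok f≡g = ∑-cong es λ m → f≡g _ (All.lookup ok m)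

    size-diff-by-labels : (es : List (Node G × Node G)) →
      ∑ es (λ e → ⟦ not (uncurry (inM G M) e) ⟧) - ∑ es (λ e → ⟦ uncurry (inM G M) e ⟧)
        ≡ ∑ (map (uncurry (inM G M)) es) unflagged−flagged
    size-diff-by-labels es = trans (sym (∑-distrib-- es _ _)) (sym (∑-map (uncurry (inM G M)) es unflagged−flagged))

  module _ {x y : Node G} {r : List (Node G)} (S : SwitchedPath x y r) where
    open SwitchedPath S

    private
      p = proj₁ (lastPair x y r)
      q = proj₂ (lastPair x y r)

    Δ-switched-path : Δ N M ≡ (wtPath G M (x ∷ y ∷ r) - ⟦ inM G M x y ⟧) - ⟦ inM G M p q ⟧
    Δ-switched-path = begin
      Δ N M                                    ≡⟨ proj₁ (∑-over-switch (x ∷ y ∷ r) distinct agreeOff) ⟩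
      ∑ (x ∷ y ∷ r) (vote N M)                 ≡⟨ ∑-path-vertices (inM G M) (vote N M) x y r alternates ⟩
      (∑ (pairs (x ∷ y ∷ r)) (unflaggedMass (inM G M) (vote N M)) + when (inM G M x y) (vote N M x))
        + when (inM G M p q) (vote N M q)
        ≡⟨ cong₂ _+_ (cong₂ _+_ (trans (∑-mass _ edges mass-vote) (sym (sumℤ-map (uncurry (wt G M)) (pairs (x ∷ y ∷ r)))))
                                (end-vote x y headEnd))
                     last-end ⟩
      (wtPath G M (x ∷ y ∷ r) - ⟦ inM G M x y ⟧) - ⟦ inM G M p q ⟧ ∎
      where
        open ≡-Reasoning
        last-end : when (inM G M p q) (vote N M q) ≡ - ⟦ inM G M p q ⟧
        last-end rewrite inM-sym M p q = end-vote q p (subst (λ b → SwitchedEnd b q) (inM-sym M p q) lastEnd)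

    size-switched-path : + size G N - + size G M ≡ (⟦ not (inM G M x y) ⟧ + ⟦ not (inM G M p q) ⟧) - 1ℤ
    size-switched-path = begin
      + size G N - + size G M
        ≡⟨ proj₂ (∑-over-switch (x ∷ y ∷ r) distinct agreeOff) ⟩
      ∑ (x ∷ y ∷ r) (matchedA N) - ∑ (x ∷ y ∷ r) (matchedA M)
        ≡⟨ cong₂ _-_ size-N size-M ⟩
      ∑ (pairs (x ∷ y ∷ r)) (λ e → ⟦ not (uncurry (inM G M) e) ⟧) - ∑ (pairs (x ∷ y ∷ r)) (λ e → ⟦ uncurry (inM G M) e ⟧)
        ≡⟨ size-diff-by-labels (pairs (x ∷ y ∷ r)) ⟩
      ∑ (labels (inM G M) (x ∷ y ∷ r)) unflagged−flagged
        ≡⟨ ∑-alternating (inM G M x y) (labels (inM G M) (y ∷ r)) alternates ⟩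
      (⟦ not (inM G M x y) ⟧ + ⟦ not (lastOf (inM G M x y) (labels (inM G M) (y ∷ r))) ⟧) - 1ℤ
        ≡⟨ cong (λ b → (⟦ not (inM G M x y) ⟧ + ⟦ not b ⟧) - 1ℤ) (lastOf-labels (inM G M) x y r) ⟩
      (⟦ not (inM G M x y) ⟧ + ⟦ not (inM G M p q) ⟧) - 1ℤ ∎
      where
        open ≡-Reasoning
        size-N : ∑ (x ∷ y ∷ r) (matchedA N) ≡ ∑ (pairs (x ∷ y ∷ r)) (λ e → ⟦ not (uncurry (inM G M) e) ⟧)
        size-N rewrite ∑-path-vertices (inM G M) (matchedA N) x y r alternates
                     | end-size-N (inM G M x y) x headEnd | end-size-N (inM G M p q) q lastEnd
                     = trans (ℤP.+-identityʳ _) (trans (ℤP.+-identityʳ _) (∑-mass _ edges mass-size-N))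
        alternates-M : Alternates (labels notInM (x ∷ y ∷ r))
        alternates-M = subst Alternates (sym (labels-not (inM G M) (x ∷ y ∷ r))) (Alternates-map-not _ alternates)
        size-M : ∑ (x ∷ y ∷ r) (matchedA M) ≡ ∑ (pairs (x ∷ y ∷ r)) (λ e → ⟦ uncurry (inM G M) e ⟧)
        size-M rewrite ∑-path-vertices notInM (matchedA M) x y r alternates-M
                     | end-size-M (inM G M x y) x headEnd | end-size-M (inM G M p q) q lastEnd
                     = trans (ℤP.+-identityʳ _) (trans (ℤP.+-identityʳ _) (∑-mass _ edges mass-size-M))

  module _ {x y : Node G} {r : List (Node G)} (S : SwitchedCycle x y r) where
    open SwitchedCycle S

    Δ-switched-cycle : Δ N M ≡ wtCycle G M (x ∷ y ∷ r)
    Δ-switched-cycle = begin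
      Δ N M                                                              ≡⟨ proj₁ (∑-over-switch (x ∷ y ∷ r) distinct agreeOff) ⟩
      ∑ (x ∷ y ∷ r) (vote N M)                                           ≡⟨ ∑-cycle-vertices (inM G M) (vote N M) x y r alternates ⟩
      ∑ (pairs (closeUp (x ∷ y ∷ r))) (unflaggedMass (inM G M) (vote N M)) ≡⟨ ∑-mass _ edges mass-vote ⟩
      ∑ (pairs (closeUp (x ∷ y ∷ r))) (uncurry (wt G M))                 ≡⟨ sym (sumℤ-map (uncurry (wt G M)) (pairs (closeUp (x ∷ y ∷ r)))) ⟩
      wtCycle G M (x ∷ y ∷ r)                                            ∎
      where open ≡-Reasoning

    size-switched-cycle : + size G N - + size G M ≡ 0ℤ
    size-switched-cycle = begin
      + size G N - + size G M
        ≡⟨ proj₂ (∑-over-switch (x ∷ y ∷ r) distinct agreeOff) ⟩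
      ∑ (x ∷ y ∷ r) (matchedA N) - ∑ (x ∷ y ∷ r) (matchedA M)
        ≡⟨ cong₂ _-_ (trans (∑-cycle-vertices (inM G M) (matchedA N) x y r alternates) (∑-mass _ edges mass-size-N))
                     (trans (∑-cycle-vertices notInM (matchedA M) x y r alternates-M) (∑-mass _ edges mass-size-M)) ⟩
      _ ≡⟨ size-diff-by-labels (pairs (closeUp (x ∷ y ∷ r))) ⟩
      ∑ (labels (inM G M) (closeUp (x ∷ y ∷ r))) unflagged−flagged
        ≡⟨ ∑-alternating-closed (inM G M x y) (labels (inM G M) (y ∷ r ++ [ x ])) alternates ⟩
      0ℤ ∎
      where
        open ≡-Reasoning
        alternates-M : Alternates (closeUp (labels notInM (closeUp (x ∷ y ∷ r))))
        alternates-M = subst Alternates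
          (trans (sym (closeUp-map not (labels (inM G M) (closeUp (x ∷ y ∷ r)))))
                 (cong closeUp (sym (labels-not (inM G M) (closeUp (x ∷ y ∷ r))))))
          (Alternates-map-not _ alternates)

module Building (G : Instance) where
  open Matchings G

  record MateFunction : Set where
    field
      partnerOf  : Node G → Maybe (Node G)
      symmetric  : ∀ {x y} → partnerOf x ≡ just y → partnerOf y ≡ just x
      alongEdges : ∀ {x y} → partnerOf x ≡ just y → adj G x y ≡ true

  private
    toB : Maybe (Node G) → Maybe (Fin (Instance.n G))
    toB (just (inj₂ b)) = just b
    toB _               = nothing

    toA : Maybe (Node G) → Maybe (Fin (Instance.m G))
    toA (just (inj₁ a)) = just a
    toA _               = nothing

    toB-just : ∀ u {b} → toB u ≡ just b → u ≡ just (inj₂ b)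
    toB-just (just (inj₂ _)) refl = refl

    toA-just : ∀ u {a} → toA u ≡ just a → u ≡ just (inj₁ a)
    toA-just (just (inj₁ _)) refl = refl

  fromMateFunction : MateFunction → Matching G
  fromMateFunction F = record
    { mateA  = λ a → toB (partnerOf (inj₁ a))
    ; mateB  = λ b → toA (partnerOf (inj₂ b))
    ; consAB = λ a b e → cong toA (symmetric (toB-just _ e))
    ; consBA = λ a b e → cong toB (symmetric (toA-just _ e))
    ; inE    = λ a b e → alongEdges (toB-just _ e)
    }
    where open MateFunction F

  mate-fromMateFunction : (F : MateFunction) (x : Node G) → mate (fromMateFunction F) x ≡ MateFunction.partnerOf F x
  mate-fromMateFunction F (inj₁ a) with MateFunction.partnerOf F (inj₁ a) in eq
  ... | nothing       = refl
  ... | just (inj₂ b) = refl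
  ... | just (inj₁ _) with MateFunction.alongEdges F eq
  ...   | ()
  mate-fromMateFunction F (inj₂ b) with MateFunction.partnerOf F (inj₂ b) in eq
  ... | nothing       = refl
  ... | just (inj₁ a) = refl
  ... | just (inj₂ _) with MateFunction.alongEdges F eq
  ...   | ()

  open DecMembership _≟ₙ_ using (_∈?_)

  Closed : Matching G → List (Node G) → Set
  Closed M K = ∀ {x y} → x ∈ K → mate M x ≡ just y → y ∈ K

  module Splice (M N : Matching G) (K : List (Node G)) (closedM : Closed M K) (closedN : Closed N K) where

    private
      partnerOf : Node G → Maybe (Node G)
      partnerOf x with x ∈? K
      ... | yes _ = mate M x
      ... | no  _ = mate N x

      symmetric : ∀ {x y} → partnerOf x ≡ just y → partnerOf y ≡ just x
      symmetric {x} {y} e with x ∈? K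
      ... | yes x∈ with y ∈? K
      ...   | yes _  = mate-sym M {x} e
      ...   | no y∉  = ⊥-elim (y∉ (closedM x∈ e))
      symmetric {x} {y} e | no x∉ with y ∈? K
      ...   | yes y∈ = ⊥-elim (x∉ (closedN y∈ (mate-sym N {x} e)))
      ...   | no _   = mate-sym N {x} e

      alongEdges : ∀ {x y} → partnerOf x ≡ just y → adj G x y ≡ true
      alongEdges {x} e with x ∈? K
      ... | yes _ = mate-adj M {x} e
      ... | no  _ = mate-adj N {x} e

    splice : Matching G
    splice = fromMateFunction record { partnerOf = partnerOf ; symmetric = symmetric ; alongEdges = alongEdges }

    mate-splice-∈ : ∀ {x} → x ∈ K → mate splice x ≡ mate M x
    mate-splice-∈ {x} x∈ with x ∈? K | mate-fromMateFunction record { partnerOf = partnerOf ; symmetric = symmetric ; alongEdges = alongEdges } x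
    ... | yes _  | e = e
    ... | no x∉ | _ = ⊥-elim (x∉ x∈)

    mate-splice-∉ : ∀ {x} → x ∉ K → mate splice x ≡ mate N x
    mate-splice-∉ {x} x∉ with x ∈? K | mate-fromMateFunction record { partnerOf = partnerOf ; symmetric = symmetric ; alongEdges = alongEdges } x
    ... | yes x∈ | _ = ⊥-elim (x∉ x∈)
    ... | no _   | e = e

bool-cases : ∀ b t → b ≡ t ⊎ b ≡ not t
bool-cases true  true  = inj₁ refl
bool-cases false false = inj₁ refl
bool-cases true  false = inj₂ refl
bool-cases false true  = inj₂ refl

module SymmetricDifference (G : Instance) (M N : Matching G) where
  open Matchings G
  open Switching G M N using (SwitchedEdge)
  open DecMembership _≟ₙ_ using (_∈?_)

  partnerIn : Bool → Node G → Maybe (Node G)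
  partnerIn true  = mate M
  partnerIn false = mate N

  partnerIn-sym : ∀ t {x y} → partnerIn t x ≡ just y → partnerIn t y ≡ just x
  partnerIn-sym true  {x} = mate-sym M {x}
  partnerIn-sym false {x} = mate-sym N {x}

  partnerIn-adj : ∀ t {x y} → partnerIn t x ≡ just y → adj G x y ≡ true
  partnerIn-adj true  {x} = mate-adj M {x}
  partnerIn-adj false {x} = mate-adj N {x}

  partnerIn-irrefl : ∀ t x → partnerIn t x ≢ just x
  partnerIn-irrefl true  = mate-irrefl M
  partnerIn-irrefl false = mate-irrefl N

  Differs : Node G → Set
  Differs x = mate M x ≢ mate N x

  differs? : ∀ x → Dec (Differs x)
  differs? x = ¬? (MaybeP.≡-dec _≟ₙ_ (mate M x) (mate N x))

  same-partner⇒agree : ∀ t {x y} → partnerIn t x ≡ just y → partnerIn (not t) x ≡ just y → ¬ Differs x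
  same-partner⇒agree true  e e′ d = d (trans e (sym e′))
  same-partner⇒agree false e e′ d = d (trans e′ (sym e))

  agree⇒partnerIn-flip : ∀ t {x} → ¬ Differs x → partnerIn t x ≡ partnerIn (not t) x
  agree⇒partnerIn-flip true  {x} a = decidable-stable (MaybeP.≡-dec _≟ₙ_ (mate M x) (mate N x)) a
  agree⇒partnerIn-flip false {x} a = sym (agree⇒partnerIn-flip true {x} a)

  data Walk : Bool → List (Node G) → Set where
    stop : ∀ {t x} → Walk t (x ∷ [])
    step : ∀ {t x y ys} → Differs x → partnerIn t x ≡ just y → Walk (not t) (y ∷ ys) → Walk t (x ∷ y ∷ ys)

  -- the kind of edge the walk t (x ∷ ys) would take next
  flagAfter : Bool → List (Node G) → Bool
  flagAfter t []       = t
  flagAfter t (_ ∷ ys) = flagAfter (not t) ys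

  Stuck : Bool → Node G → Set
  Stuck t x = Differs x → partnerIn t x ≡ nothing

  Continues : Bool → Node G → Node G → Set
  Continues t x z = Differs x × partnerIn t x ≡ just z

  step-label : ∀ t {x y} → Differs x → partnerIn t x ≡ just y → inM G M x y ≡ t
  step-label true  {x} {y} d e = mate⇒inM M x y e
  step-label false {x} {y} d e with inM G M x y in xy
  ... | false = refl
  ... | true  = ⊥-elim (d (trans (inM⇒mate M x y xy) (sym e)))

  step-switched : ∀ t {x y} → Differs x → partnerIn t x ≡ just y → SwitchedEdge (x , y)
  step-switched t {x} {y} d e = partnerIn-adj t {x} e , in-N t e
    where
      in-N : ∀ t → partnerIn t x ≡ just y → inM G M x y ≡ false → mate N x ≡ just y
      in-N true  e f with trans (sym f) (mate⇒inM M x y e)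
      ... | ()
      in-N false e f = e

  Walk-head-label : ∀ {t x y ys} → Walk t (x ∷ y ∷ ys) → inM G M x y ≡ t
  Walk-head-label {t} (step d e _) = step-label t d e

  Walk⇒Alternates : ∀ {t x y ys} → Walk t (x ∷ y ∷ ys) → Alternates (labels (inM G M) (x ∷ y ∷ ys))
  Walk⇒Alternates (step d e stop) = []
  Walk⇒Alternates {t} (step d e w@(step _ _ _)) =
    (λ q → BoolP.not-¬ refl (trans (sym (step-label t d e)) (trans q (Walk-head-label w)))) ∷ Walk⇒Alternates w

  Walk⇒SwitchedEdges : ∀ {t L} → Walk t L → All SwitchedEdge (pairs L)
  Walk⇒SwitchedEdges stop                = []
  Walk⇒SwitchedEdges {t} (step d e stop) = step-switched t d e ∷ []
  Walk⇒SwitchedEdges {t} (step d e w@(step _ _ _)) = step-switched t d e ∷ Walk⇒SwitchedEdges w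

  Walk-snoc : ∀ {t x} ys {w} → Walk t (x ∷ ys) → Continues (flagAfter t ys) (lastOf x ys) w → Walk t (x ∷ ys ++ [ w ])
  Walk-snoc []       stop          (d , e) = step d e stop
  Walk-snoc (y ∷ ys) (step d e w) c       = step d e (Walk-snoc ys w c)

  Walk-last-label : ∀ {t x y} ys → Walk t (x ∷ y ∷ ys) → uncurry (inM G M) (lastPair x y ys) ≡ not (flagAfter t (y ∷ ys))
  Walk-last-label {t} []       (step d e stop) = trans (step-label t d e) (sym (BoolP.not-involutive t))
  Walk-last-label     (z ∷ ys) (step d e w)    = Walk-last-label ys w

  -- the last node differs, since it was reached along an edge of exactly one of M and N
  Walk-stuck : ∀ {t x y} ys → Walk t (x ∷ y ∷ ys) → Stuck (flagAfter t (y ∷ ys)) (lastOf y ys) →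
               partnerIn (flagAfter t (y ∷ ys)) (lastOf y ys) ≡ nothing
  Walk-stuck {t} {x} {y} [] (step d e stop) stuck with differs? y
  ... | yes dy = stuck dy
  ... | no  ay = ⊥-elim (same-partner⇒agree t e
                   (partnerIn-sym (not t) (trans (sym (agree⇒partnerIn-flip t ay)) (partnerIn-sym t e))) d)
  Walk-stuck (z ∷ ys) (step d e w) stuck = Walk-stuck ys w stuck

  PartnerWithin : List (Node G) → Maybe (Node G) → Set
  PartnerWithin W u = ∀ {y} → u ≡ just y → y ∈ W

  Walk-partners-within : ∀ {t x} ys (W : List (Node G)) → Walk t (x ∷ ys) → (∀ {z} → z ∈ x ∷ ys → z ∈ W) →
    PartnerWithin W (partnerIn (not t) x) → PartnerWithin W (partnerIn (flagAfter t ys) (lastOf x ys)) →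
    ∀ {v} → v ∈ x ∷ ys → ∀ b → PartnerWithin W (partnerIn b v)
  Walk-partners-within {t} [] W stop sub first last (here refl) b with bool-cases b t
  ... | inj₁ refl = last
  ... | inj₂ refl = first
  Walk-partners-within {t} (y ∷ ys) W (step d e w) sub first last (here refl) b with bool-cases b t
  ... | inj₁ refl = λ e′ → subst (_∈ W) (MaybeP.just-injective (trans (sym e) e′)) (sub (there (here refl)))
  ... | inj₂ refl = first
  Walk-partners-within {t} {x} (y ∷ ys) W (step d e w) sub first last (there v∈) b =
    Walk-partners-within ys W w (λ z∈ → sub (there z∈)) back last v∈ b
    where
      back : PartnerWithin W (partnerIn (not (not t)) y)
      back e′ = subst (_∈ W) (MaybeP.just-injective (trans (sym (partnerIn-sym t e))
                                (trans (cong (λ b → partnerIn b y) (sym (BoolP.not-involutive t))) e′)))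
                      (sub (here refl))

  Walk-no-inner-return : ∀ {t x} ys {w} → Walk t (x ∷ ys) → Unique (x ∷ ys) → w ∈ ys →
                         partnerIn (flagAfter t ys) (lastOf x ys) ≡ just w → ⊥
  Walk-no-inner-return (y ∷ ys) (step d e w) u (there w∈) back = Walk-no-inner-return ys w (AllPairs.tail u) w∈ back
  Walk-no-inner-return {t} {x} (y ∷ ys) (step d e w) u (here refl) back with bool-cases (flagAfter (not t) ys) t
  ... | inj₁ s≡t = lastOf≢head u (MaybeP.just-injective (trans (sym (partnerIn-sym t (subst (λ s → partnerIn s _ ≡ just y) s≡t back)))
                                                         (partnerIn-sym t e)))
  ... | inj₂ s≡¬t = inner ys w (AllPairs.tail u) s≡¬t (subst (λ s → partnerIn s _ ≡ just y) s≡¬t back)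
    where
      inner : ∀ ys → Walk (not t) (y ∷ ys) → Unique (y ∷ ys) → flagAfter (not t) ys ≡ not t →
              partnerIn (not t) (lastOf y ys) ≡ just y → ⊥
      inner []               stop                  _  _   back = partnerIn-irrefl (not t) y back
      inner (y₂ ∷ [])        (step _ _ stop)       _  s≡¬t _   = BoolP.not-¬ refl (sym s≡¬t)
      inner (y₂ ∷ y₃ ∷ ys′) (step _ e₂ _)         u′ _    back =
        lastOf≢head (AllPairs.tail u′) (MaybeP.just-injective (trans (sym (partnerIn-sym (not t) back)) e₂))

  -- a walk along distinct nodes that returns to its first node closes an even cycle
  Walk-return-flips : ∀ {t x} ys → Walk t (x ∷ ys) → Unique (x ∷ ys) →
                      partnerIn (flagAfter t ys) (lastOf x ys) ≡ just x → flagAfter t ys ≡ not t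
  Walk-return-flips {t} {x} []       stop         u back = ⊥-elim (partnerIn-irrefl t x back)
  Walk-return-flips {t} {x} (y ∷ ys) (step d e w) u back with bool-cases (flagAfter (not t) ys) t
  ... | inj₂ s≡¬t = s≡¬t
  ... | inj₁ s≡t  = ⊥-elim (odd ys (AllPairs.tail u) s≡t last≡y)
    where
      last≡y : lastOf y ys ≡ y
      last≡y = MaybeP.just-injective (trans (sym (partnerIn-sym t (subst (λ s → partnerIn s _ ≡ just x) s≡t back))) e)
      odd : ∀ ys → Unique (y ∷ ys) → flagAfter (not t) ys ≡ t → lastOf y ys ≡ y → ⊥
      odd []        _ s≡t _      = BoolP.not-¬ refl (sym s≡t)
      odd (y₂ ∷ ys) u s≡t last≡y = lastOf≢head u last≡y

  data WalkResult (fuel : ℕ) (t : Bool) (x : Node G) (visited : List (Node G)) : Set where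
    stuck     : ∀ ys → Walk t (x ∷ ys) → Unique ys → All (_∉ visited) ys →
                Stuck (flagAfter t ys) (lastOf x ys) → WalkResult fuel t x visited
    returns   : ∀ ys {z} → Walk t (x ∷ ys) → Unique ys → All (_∉ visited) ys →
                Continues (flagAfter t ys) (lastOf x ys) z → z ∈ visited ⊎ z ∈ ys → WalkResult fuel t x visited
    outOfFuel : ∀ ys → Unique ys → All (_∉ visited) ys → length ys ≡ fuel → WalkResult fuel t x visited

  private
    extend : ∀ {y : Node G} {visited} ys → Unique ys → All (_∉ y ∷ visited) ys → Unique (y ∷ ys)
    extend ys u new = ∉⇒Unique∷ (λ y∈ys → All.lookup new y∈ys (here refl)) u

    older : ∀ {y : Node G} {visited} ys → All (_∉ y ∷ visited) ys → All (_∉ visited) ys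
    older ys = All.map (λ z∉ z∈ → z∉ (there z∈))

    shift : ∀ {y z : Node G} {visited ys} → z ∈ y ∷ visited ⊎ z ∈ ys → z ∈ visited ⊎ z ∈ y ∷ ys
    shift (inj₁ (here e))  = inj₂ (here e)
    shift (inj₁ (there m)) = inj₁ m
    shift (inj₂ m)         = inj₂ (there m)

  walk : ∀ fuel t x visited → WalkResult fuel t x visited
  walk zero    t x visited = outOfFuel [] [] [] refl
  walk (suc f) t x visited with differs? x | partnerIn t x in e
  ... | no ax  | _       = stuck [] stop [] [] (λ d → ⊥-elim (ax d))
  ... | yes dx | nothing = stuck [] stop [] [] (λ _ → e)
  ... | yes dx | just y with y ∈? visited
  ...   | yes y∈ = returns [] stop [] [] (dx , e) (inj₁ y∈)
  ...   | no  y∉ with walk f (not t) y (y ∷ visited)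
  ...     | stuck ys w u new s      = stuck (y ∷ ys) (step dx e w) (extend ys u new) (y∉ ∷ older ys new) s
  ...     | returns ys w u new c z∈ = returns (y ∷ ys) (step dx e w) (extend ys u new) (y∉ ∷ older ys new) c (shift z∈)
  ...     | outOfFuel ys u new len  = outOfFuel (y ∷ ys) (extend ys u new) (y∉ ∷ older ys new) (cong suc len)

module Components (G : Instance) (M N : Matching G) where
  open Matchings G
  open Building G
  open SymmetricDifference G M N

  module Restrict (K : List (Node G)) (closedM : Closed M K) (closedN : Closed N K) where
    open Splice N M K closedN closedM public
    open Switching G M splice public

    switched-end : ∀ t {z} → z ∈ K → partnerIn (not t) z ≡ nothing → SwitchedEnd t z
    switched-end true  z∈ e = trans (mate-splice-∈ z∈) e
    switched-end false z∈ e = e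

    switched-edges : ∀ L → (∀ {e} → e ∈ pairs L → proj₁ e ∈ K) →
                     All (Switching.SwitchedEdge G M N) (pairs L) → All SwitchedEdge (pairs L)
    switched-edges L inK sw = All.tabulate λ {e} e∈ → lift (inK e∈) (All.lookup sw e∈)
      where
        lift : ∀ {p q} → p ∈ K → Switching.SwitchedEdge G M N (p , q) → SwitchedEdge (p , q)
        lift p∈ (pq , new) = pq , λ f → trans (mate-splice-∈ p∈) (new f)

  record Component : Set where
    field
      x y      : Node G
      r        : List (Node G)
      closedM  : Closed M (x ∷ y ∷ r)
      closedN  : Closed N (x ∷ y ∷ r)
      differs  : Differs x
    open Restrict (x ∷ y ∷ r) closedM closedN using (SwitchedPath; SwitchedCycle)
    field
      shape    : SwitchedPath x y r ⊎ SwitchedCycle x y r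

  private
    fuel : ℕ
    fuel = length allNodes

    start-unique : ∀ {x : Node G} ys → Unique ys → All (_∉ x ∷ []) ys → Unique (x ∷ ys)
    start-unique ys u new = ∉⇒Unique∷ (λ x∈ → All.lookup new x∈ (here refl)) u

    enough-fuel : ∀ {x : Node G} ys → Unique ys → All (_∉ x ∷ []) ys → length ys ≢ fuel
    enough-fuel {x} ys u new len = ℕP.<-irrefl len
      (length-mono-Unique (x ∷ ys) allNodes (start-unique ys u new) λ _ → ∈-allNodes _)

    Walk-closed : ∀ {t x} ys → Walk t (x ∷ ys) →
      PartnerWithin (x ∷ ys) (partnerIn (not t) x) → PartnerWithin (x ∷ ys) (partnerIn (flagAfter t ys) (lastOf x ys)) →
      Closed M (x ∷ ys) × Closed N (x ∷ ys)
    Walk-closed ys w first last =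
      (λ v∈ e → Walk-partners-within ys _ w (λ z∈ → z∈) first last v∈ true e) ,
      (λ v∈ e → Walk-partners-within ys _ w (λ z∈ → z∈) first last v∈ false e)

    Walk-before-last : ∀ {t x y} ys → Walk t (x ∷ y ∷ ys) →
                       ∃ λ p → partnerIn (not (flagAfter t (y ∷ ys))) (lastOf y ys) ≡ just p
    Walk-before-last {t} {x} {y} [] (step d e stop) =
      x , subst (λ s → partnerIn s y ≡ just x) (sym (BoolP.not-involutive t)) (partnerIn-sym t e)
    Walk-before-last (z ∷ ys) (step d e w) = Walk-before-last ys w

    nothing≢just : ∀ {v : Node G} → nothing ≢ just v
    nothing≢just ()

  IsEnd : Node G → Set
  IsEnd z = Differs z × (mate M z ≡ nothing ⊎ mate N z ≡ nothing)

  pathComponent : ∀ t {z y₁} → Differs z → partnerIn t z ≡ just y₁ → partnerIn (not t) z ≡ nothing → Component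
  pathComponent t {z} dz first none with walk fuel t z (z ∷ [])
  ... | outOfFuel ys u new len = ⊥-elim (enough-fuel ys u new len)
  ... | returns ys w u new (_ , back) (inj₂ w∈) = ⊥-elim (Walk-no-inner-return ys w (start-unique ys u new) w∈ back)
  ... | returns ys w u new (_ , back) (inj₁ (here refl)) =
          ⊥-elim (nothing≢just (trans (sym none)
            (partnerIn-sym (not t) (subst (λ s → partnerIn s _ ≡ just z) (Walk-return-flips ys w (start-unique ys u new) back) back))))
  ... | stuck [] stop _ _ s = ⊥-elim (nothing≢just (trans (sym (s dz)) first))
  ... | stuck (y ∷ r) w u new s = record
          { x = z ; y = y ; r = r ; closedM = proj₁ closed ; closedN = proj₂ closed ; differs = dz ; shape = inj₁ path }
    where
      K = z ∷ y ∷ r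
      end-none = Walk-stuck r w s
      vacuous : ∀ {u} → u ≡ nothing → PartnerWithin K u
      vacuous refl ()
      closed = Walk-closed (y ∷ r) w (vacuous none) (vacuous end-none)
      open Restrict K (proj₁ closed) (proj₂ closed)
      last-flag = flagAfter t (y ∷ r)
      path : SwitchedPath z y r
      path = record
        { distinct   = start-unique (y ∷ r) u new
        ; alternates = Walk⇒Alternates w
        ; edges      = switched-edges K (∈-pairs-proj₁ K) (Walk⇒SwitchedEdges w)
        ; agreeOff   = λ _ → mate-splice-∉
        ; headEnd    = subst (λ b → SwitchedEnd b z) (sym (Walk-head-label w)) (switched-end t (here refl) none)
        ; lastEnd    = subst₂ SwitchedEnd (sym (Walk-last-label r w)) (sym (proj₂-lastPair z y r))
                         (switched-end (not last-flag) (lastOf-∈ z (y ∷ r))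
                           (subst (λ b → partnerIn b _ ≡ nothing) (sym (BoolP.not-involutive last-flag)) end-none))
        }

  returning-walk-component : ∀ {x₀ y y₂} r → Differs x₀ → Walk true (x₀ ∷ y ∷ y₂ ∷ r) → Unique (x₀ ∷ y ∷ y₂ ∷ r) →
                             Continues (flagAfter true (y ∷ y₂ ∷ r)) (lastOf x₀ (y ∷ y₂ ∷ r)) x₀ → Component
  returning-walk-component {x₀} {y} {y₂} r dx w u (dz , back) = record
    { x = x₀ ; y = y ; r = y₂ ∷ r ; closedM = proj₁ closed ; closedN = proj₂ closed ; differs = dx ; shape = inj₂ cycle }
    where
      ys = y ∷ y₂ ∷ r
      K  = x₀ ∷ ys
      s  = flagAfter true ys
      z  = lastOf x₀ ys
      s≡false : s ≡ false
      s≡false = Walk-return-flips ys w u back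
      first-within : PartnerWithin K (partnerIn false x₀)
      first-within e = subst (_∈ K) (MaybeP.just-injective (trans (sym (partnerIn-sym false (subst (λ b → partnerIn b z ≡ just x₀) s≡false back))) e))
                             (lastOf-∈ x₀ ys)
      last-within : PartnerWithin K (partnerIn s z)
      last-within e = subst (_∈ K) (MaybeP.just-injective (trans (sym back) e)) (here refl)
      closed = Walk-closed ys w first-within last-within
      open Restrict K (proj₁ closed) (proj₂ closed)
      closing-walk : Walk true (x₀ ∷ ys ++ [ x₀ ])
      closing-walk = Walk-snoc ys w (dz , back)
      closing-label : lastOf (inM G M x₀ y) (labels (inM G M) (y ∷ (y₂ ∷ r) ++ [ x₀ ])) ≢ inM G M x₀ y
      closing-label eq with trans (sym (trans (lastOf-labels (inM G M) x₀ y ((y₂ ∷ r) ++ [ x₀ ]))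
                                       (trans (cong (uncurry (inM G M)) (lastPair-snoc x₀ y (y₂ ∷ r) x₀))
                                              (trans (step-label s dz back) s≡false))))
                            (trans eq (Walk-head-label w))
      ... | ()
      cycle : SwitchedCycle x₀ y (y₂ ∷ r)
      cycle = record
        { distinct   = u
        ; alternates = Alternates-snoc⁺ (inM G M x₀ y) (labels (inM G M) (y ∷ (y₂ ∷ r) ++ [ x₀ ]))
                         (Walk⇒Alternates closing-walk) closing-label
        ; edges      = switched-edges (closeUp K) (λ e∈ → ∈-closeUp⁻ K (∈-pairs-proj₁ (closeUp K) e∈))
                         (Walk⇒SwitchedEdges closing-walk)
        ; agreeOff   = λ _ → mate-splice-∉
        }

  cycleComponent : ∀ {x₀ y₁} → Differs x₀ → mate M x₀ ≡ just y₁ → (∀ z → ¬ IsEnd z) → Component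
  cycleComponent {x₀} dx first no-end with walk fuel true x₀ (x₀ ∷ [])
  ... | outOfFuel ys u new len = ⊥-elim (enough-fuel ys u new len)
  ... | returns ys w u new (_ , back) (inj₂ w∈) = ⊥-elim (Walk-no-inner-return ys w (start-unique ys u new) w∈ back)
  ... | stuck [] stop _ _ s = ⊥-elim (nothing≢just (trans (sym (s dx)) first))
  ... | stuck (y ∷ r) w u new s with Walk-before-last r w
  ...   | p , before = ⊥-elim (no-end (lastOf y r) (end (flagAfter true (y ∷ r)) {lastOf y r} (Walk-stuck r w s) before))
    where
      end : ∀ s {z} → partnerIn s z ≡ nothing → partnerIn (not s) z ≡ just p → IsEnd z
      end true  e e′ = (λ eq → nothing≢just (trans (sym e) (trans eq e′))) , inj₁ e
      end false e e′ = (λ eq → nothing≢just (trans (sym e) (trans (sym eq) e′))) , inj₂ e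
  cycleComponent dx first no-end | returns [] stop _ _ (_ , back) (inj₁ (here refl)) = ⊥-elim (partnerIn-irrefl true _ back)
  cycleComponent {x₀} dx first no-end | returns (y ∷ []) (step _ e stop) _ _ (dy , back) (inj₁ (here refl)) =
    ⊥-elim (same-partner⇒agree true {y} (mate-sym M {x₀} e) back dy)
  cycleComponent {x₀} dx first no-end | returns (y ∷ y₂ ∷ r) w u new c (inj₁ (here refl)) =
    returning-walk-component r dx w (start-unique (y ∷ y₂ ∷ r) u new) c

  private
    unmatched-both⇒agree : ∀ t {z} → partnerIn t z ≡ nothing → partnerIn (not t) z ≡ nothing → ¬ Differs z
    unmatched-both⇒agree true  e e′ d = d (trans e (sym e′))
    unmatched-both⇒agree false e e′ d = d (trans e′ (sym e))

    from-end : ∀ t {z} → Differs z → partnerIn (not t) z ≡ nothing → Component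
    from-end t {z} dz none = from-partner (partnerIn t z) refl
      where
        from-partner : ∀ u → partnerIn t z ≡ u → Component
        from-partner nothing  e = ⊥-elim (unmatched-both⇒agree t e none dz)
        from-partner (just _) e = pathComponent t {z} dz e none

    is-end? : ∀ z → Dec (IsEnd z)
    is-end? z = differs? z ×-dec (MaybeP.≡-dec _≟ₙ_ (mate M z) nothing ⊎-dec MaybeP.≡-dec _≟ₙ_ (mate N z) nothing)

    find-end : (L : List (Node G)) → (∃ IsEnd) ⊎ (∀ {z} → z ∈ L → ¬ IsEnd z)
    find-end []      = inj₂ λ ()
    find-end (z ∷ L) with is-end? z | find-end L
    ... | yes e | _       = inj₁ (z , e)
    ... | no ¬e | inj₁ f  = inj₁ f
    ... | no ¬e | inj₂ nf = inj₂ λ { (here refl) → ¬e ; (there m) → nf m }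

  component : ∀ {x₀} → Differs x₀ → Component
  component {x₀} dx with find-end allNodes
  ... | inj₁ (z , dz , inj₁ unmatchedM) = from-end false {z} dz unmatchedM
  ... | inj₁ (z , dz , inj₂ unmatchedN) = from-end true {z} dz unmatchedN
  ... | inj₂ no-end = from-partner (mate M x₀) refl
    where
      from-partner : ∀ u → mate M x₀ ≡ u → Component
      from-partner nothing  e = ⊥-elim (no-end (∈-allNodes x₀) (dx , inj₁ e))
      from-partner (just _) e = cycleComponent {x₀} dx e λ z → no-end (∈-allNodes z)

module Sufficiency (G : Instance) (M : Matching G) (maxM : IsMaximum G M)
  (no-positive-cycle : ∀ (C : List (Node G)) → IsAltCycle G M C → ¬ (0ℤ < wtCycle G M C))
  (no-positive-path : ∀ (p : List (Node G)) → IsAltPath G M p → HasUnmatchedEnd G M p → ¬ (0ℤ < wtPath G M p))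
  where
  open Matchings G
  open Building G

  module _ {N : Matching G} where
    open Switching G M N

    private
      W-1≤0 : ∀ {W} → W ≤ 0ℤ → W - 1ℤ ≤ 0ℤ
      W-1≤0 = ℤP.i≤j⇒i-k≤j 1ℤ

    switched-path-Δ≤0 : ∀ {x y r} → SwitchedPath x y r → size G N ≡ size G M → Δ N M ≤ 0ℤ
    switched-path-Δ≤0 {x} {y} {r} S same-size = by-end-labels (inM G M x y) refl (inM G M p q) refl
      where
        open SwitchedPath S
        p = proj₁ (lastPair x y r)
        q = proj₂ (lastPair x y r)
        W = wtPath G M (x ∷ y ∷ r)
        alt-path : IsAltPath G M (x ∷ y ∷ r)
        alt-path = record { nonTrivial = ℕ.s≤s (ℕ.s≤s ℕ.z≤n) ; distinct = distinct
                          ; edges = All.map proj₁ edges ; alternates = alternates }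
        W≤0 : HasUnmatchedEnd G M (x ∷ y ∷ r) → W ≤ 0ℤ
        W≤0 free = ℤP.≮⇒≥ (no-positive-path (x ∷ y ∷ r) alt-path free)
        one-M-end : (⟦ not (inM G M x y) ⟧ + ⟦ not (inM G M p q) ⟧) - 1ℤ ≡ 0ℤ
        one-M-end = trans (sym (size-switched-path S)) (trans (cong (λ s → + s - + size G M) same-size) (ℤP.+-inverseʳ (+ size G M)))
        by-end-labels : ∀ a → inM G M x y ≡ a → ∀ b → inM G M p q ≡ b → Δ N M ≤ 0ℤ
        by-end-labels true  ea true  eb with trans (cong₂ (λ u v → (⟦ not u ⟧ + ⟦ not v ⟧) - 1ℤ) (sym ea) (sym eb)) one-M-end
        ... | ()
        by-end-labels false ea false eb with trans (cong₂ (λ u v → (⟦ not u ⟧ + ⟦ not v ⟧) - 1ℤ) (sym ea) (sym eb)) one-M-end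
        ... | ()
        by-end-labels false ea true eb = subst (_≤ 0ℤ) (sym (trans (Δ-switched-path S) (cong₂ (λ u v → (W - ⟦ u ⟧) - ⟦ v ⟧) ea eb)))
          (W-1≤0 (subst (_≤ 0ℤ) (sym (ℤP.+-identityʳ W))
            (W≤0 (x , inj₁ refl , mate≡nothing⇒unmatched M x (subst (λ b → SwitchedEnd b x) ea headEnd)))))
        by-end-labels true ea false eb = subst (_≤ 0ℤ) (sym (trans (Δ-switched-path S) (cong₂ (λ u v → (W - ⟦ u ⟧) - ⟦ v ⟧) ea eb)))
          (subst (_≤ 0ℤ) (sym (ℤP.+-identityʳ (W - 1ℤ)))
            (W-1≤0 (W≤0 (q , inj₂ (last-lastPair x y r) , mate≡nothing⇒unmatched M q (subst (λ b → SwitchedEnd b q) eb lastEnd)))))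

    switched-cycle-Δ≤0 : ∀ {x y r} → SwitchedCycle x y r → Δ N M ≤ 0ℤ
    switched-cycle-Δ≤0 {x} {y} {[]} S with Alternates-snoc⁻ (inM G M x y) (inM G M y x ∷ []) (SwitchedCycle.alternates S)
    ... | (xy≢yx ∷ []) , _ = ⊥-elim (xy≢yx (inM-sym M x y))
    switched-cycle-Δ≤0 {x} {y} {z ∷ r} S =
      subst (_≤ 0ℤ) (sym (Δ-switched-cycle S)) (ℤP.≮⇒≥ (no-positive-cycle (x ∷ y ∷ z ∷ r) alt-cycle))
      where
        open SwitchedCycle S
        alt-cycle : IsAltCycle G M (x ∷ y ∷ z ∷ r)
        alt-cycle = record { nonTrivial = ℕ.s≤s (ℕ.s≤s (ℕ.s≤s ℕ.z≤n)) ; distinct = distinct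
                           ; edges = All.map proj₁ edges ; alternates = alternates }

  disagreement : Matching G → Node G → ℤ
  disagreement X x = ⟦ not (does (MaybeP.≡-dec _≟ₙ_ (mate M x) (mate X x))) ⟧

  disagreements : Matching G → ℕ
  disagreements X = ℤ.∣ ∑ allNodes (disagreement X) ∣

  disagreement-cong : ∀ {X Y : Matching G} x → mate X x ≡ mate Y x → disagreement X x ≡ disagreement Y x
  disagreement-cong {X} {Y} x e rewrite e = refl

  disagreement-self : ∀ x → disagreement M x ≡ 0ℤ
  disagreement-self x with MaybeP.≡-dec _≟ₙ_ (mate M x) (mate M x)
  ... | yes _ = refl
  ... | no ne = ⊥-elim (ne refl)

  disagreement-differs : ∀ (X : Matching G) x → mate M x ≢ mate X x → disagreement X x ≡ 1ℤ
  disagreement-differs X x ne with MaybeP.≡-dec _≟ₙ_ (mate M x) (mate X x)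
  ... | yes e = ⊥-elim (ne e)
  ... | no _  = refl

  disagreement-nonneg : ∀ (X : Matching G) x → 0ℤ ≤ disagreement X x
  disagreement-nonneg X x with does (MaybeP.≡-dec _≟ₙ_ (mate M x) (mate X x))
  ... | true  = ℤP.≤-refl
  ... | false = ℤ.+≤+ ℕ.z≤n

  bounded-sum-tight : ∀ {a b s} → a ℕ.+ b ≡ s ℕ.+ s → a ℕ.≤ s → b ℕ.≤ s → a ≡ s × b ≡ s
  bounded-sum-tight {a} {b} {s} sum a≤s b≤s =
    ℕP.≤-antisym a≤s (ℕP.+-cancelʳ-≤ s s a (subst (ℕ._≤ a ℕ.+ s) sum (ℕP.+-monoʳ-≤ a b≤s))) ,
    ℕP.≤-antisym b≤s (ℕP.+-cancelˡ-≤ s s b (subst (ℕ._≤ s ℕ.+ b) sum (ℕP.+-monoˡ-≤ b a≤s)))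

  module SplitAlong (N : Matching G) (C : Components.Component G M N) where
    open Components.Component C
    open DecMembership _≟ₙ_ using (_∈?_)

    private
      K : List (Node G)
      K = x ∷ y ∷ r

    open Splice M N K closedM closedN public using ()
      renaming (splice to N′; mate-splice-∈ to N′-on-K; mate-splice-∉ to N′-off-K)
    open Splice N M K closedN closedM public using ()
      renaming (splice to N″; mate-splice-∈ to N″-on-K; mate-splice-∉ to N″-off-K)

    size-split : size G N′ ℕ.+ size G N″ ≡ size G M ℕ.+ size G N
    size-split = ℤP.+-injective (begin
      + (size G N′ ℕ.+ size G N″)                      ≡⟨ ℤP.pos-+ (size G N′) (size G N″) ⟩
      + size G N′ + + size G N″                        ≡⟨ cong₂ _+_ (size-as-∑ N′) (size-as-∑ N″) ⟩
      ∑ allNodes (matchedA N′) + ∑ allNodes (matchedA N″) ≡⟨ sym (∑-distrib-+ allNodes _ _) ⟩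
      ∑ allNodes (λ z → matchedA N′ z + matchedA N″ z)   ≡⟨ ∑-cong allNodes (λ {z} _ → pointwise z) ⟩
      ∑ allNodes (λ z → matchedA M z + matchedA N z)     ≡⟨ ∑-distrib-+ allNodes _ _ ⟩
      ∑ allNodes (matchedA M) + ∑ allNodes (matchedA N)  ≡⟨ sym (cong₂ _+_ (size-as-∑ M) (size-as-∑ N)) ⟩
      + size G M + + size G N                          ≡⟨ sym (ℤP.pos-+ (size G M) (size G N)) ⟩
      + (size G M ℕ.+ size G N)                        ∎)
      where
        open ≡-Reasoning
        pointwise : ∀ z → matchedA N′ z + matchedA N″ z ≡ matchedA M z + matchedA N z
        pointwise z with z ∈? K
        ... | yes z∈ = cong₂ _+_ (matchedA-cong z (N′-on-K z∈)) (matchedA-cong z (N″-on-K z∈))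
        ... | no  z∉ = trans (cong₂ _+_ (matchedA-cong z (N′-off-K z∉)) (matchedA-cong z (N″-off-K z∉)))
                             (ℤP.+-comm (matchedA N z) (matchedA M z))

    Δ-split : Δ N M ≡ Δ N″ M + Δ N′ M
    Δ-split = begin
      Δ N M                                        ≡⟨ Δ-as-∑ N M ⟩
      ∑ allNodes (vote N M)                        ≡⟨ ∑-cong allNodes (λ {z} _ → pointwise z) ⟩
      ∑ allNodes (λ z → vote N″ M z + vote N′ M z)  ≡⟨ ∑-distrib-+ allNodes _ _ ⟩
      ∑ allNodes (vote N″ M) + ∑ allNodes (vote N′ M) ≡⟨ sym (cong₂ _+_ (Δ-as-∑ N″ M) (Δ-as-∑ N′ M)) ⟩
      Δ N″ M + Δ N′ M                              ∎
      where
        open ≡-Reasoning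
        pointwise : ∀ z → vote N M z ≡ vote N″ M z + vote N′ M z
        pointwise z with z ∈? K
        ... | yes z∈ = trans (vote-cong z (sym (N″-on-K z∈)) refl)
                             (trans (sym (ℤP.+-identityʳ _)) (cong (_+_ (vote N″ M z)) (sym (vote-same N′ M z (N′-on-K z∈)))))
        ... | no  z∉ = trans (vote-cong z (sym (N′-off-K z∉)) refl)
                             (trans (sym (ℤP.+-identityˡ _)) (cong (_+ vote N′ M z) (sym (vote-same N″ M z (N″-off-K z∉)))))

    fewer-disagreements : disagreements N′ ℕ.< disagreements N
    fewer-disagreements = ℤP.drop‿+<+ (subst₂ _<_ (sym (ℤP.0≤i⇒+∣i∣≡i (∑-nonneg allNodes (disagreement-nonneg N′))))
                                                   (sym (ℤP.0≤i⇒+∣i∣≡i (∑-nonneg allNodes (disagreement-nonneg N))))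
      (∑-mono-<-at allNodes pointwise (∈-allNodes x)
        (subst₂ _<_ (sym (trans (disagreement-cong x (N′-on-K (here refl))) (disagreement-self x)))
                    (sym (disagreement-differs N x differs)) (ℤ.+<+ (ℕ.s≤s ℕ.z≤n)))))
      where
        pointwise : ∀ z → disagreement N′ z ≤ disagreement N z
        pointwise z with z ∈? K
        ... | yes z∈ = subst (_≤ disagreement N z) (sym (trans (disagreement-cong z (N′-on-K z∈)) (disagreement-self z)))
                             (disagreement-nonneg N z)
        ... | no  z∉ = ℤP.≤-reflexive (disagreement-cong z (N′-off-K z∉))

    Δ″≤0 : size G N″ ≡ size G M → Δ N″ M ≤ 0ℤ
    Δ″≤0 same-size with shape
    ... | inj₁ path  = switched-path-Δ≤0 path same-size
    ... | inj₂ cycle = switched-cycle-Δ≤0 cycle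

  maximum⇒Δ≤0 : ∀ k (N : Matching G) → IsMaximum G N → disagreements N ℕ.< k → Δ N M ≤ 0ℤ
  maximum⇒Δ≤0 (suc k) N maxN bound with any? (SymmetricDifference.differs? G M N) allNodes
  ... | no none = ℤP.≤-reflexive (trans (Δ-as-∑ N M) (∑-zero allNodes λ {z} z∈ → vote-same N M z (sym (agree z∈))))
    where
      agree : ∀ {z} → z ∈ allNodes → mate M z ≡ mate N z
      agree {z} z∈ = decidable-stable (MaybeP.≡-dec _≟ₙ_ (mate M z) (mate N z)) λ d → none (lose z∈ d)
  ... | yes some =
    subst (_≤ 0ℤ) (sym Δ-split)
      (ℤP.+-mono-≤ (Δ″≤0 (proj₂ tight)) (maximum⇒Δ≤0 k N′ maxN′ (ℕP.<-≤-trans fewer-disagreements (ℕ.s≤s⁻¹ bound))))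
    where
      open SplitAlong N (Components.component G M N {proj₁ (satisfied some)} (proj₂ (satisfied some)))
      tight = bounded-sum-tight (trans size-split (cong (size G M ℕ.+_) (ℕP.≤-antisym (maxM N) (maxN M)))) (maxM N′) (maxM N″)
      maxN′ : IsMaximum G N′
      maxN′ X = subst (size G X ℕ.≤_) (sym (proj₁ tight)) (maxM X)

  popular : IsPopularMaxMatching G M
  popular = maxM , λ N maxN → ℤP.drop‿+≤+ (ℤP.i-j≤0⇒i≤j (maximum⇒Δ≤0 _ N maxN (ℕP.n<1+n _)))

module Flipping (G : Instance) (M : Matching G) where
  open Matchings G
  open Building G

  NonM : Node G × Node G → Set
  NonM (p , q) = inM G M p q ≡ false

  Touches : Node G × Node G → Node G → Set
  Touches (p , q) z = p ≡ z ⊎ q ≡ z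

  Apart : Node G × Node G → Node G × Node G → Set
  Apart e e′ = NonM e → NonM e′ → ∀ {z} → Touches e z → ¬ Touches e′ z

  flipPartner : List (Node G × Node G) → Node G → Maybe (Node G)
  flipPartner []             z = nothing
  flipPartner ((p , q) ∷ es) z with inM G M p q | p ≟ₙ z | q ≟ₙ z
  ... | true  | _     | _     = flipPartner es z
  ... | false | yes _ | _     = just q
  ... | false | no _  | yes _ = just p
  ... | false | no _  | no _  = flipPartner es z

  flipPartner-skip : ∀ e es z → (NonM e → ¬ Touches e z) → flipPartner (e ∷ es) z ≡ flipPartner es z
  flipPartner-skip (p , q) es z away with inM G M p q in pq | p ≟ₙ z | q ≟ₙ z
  ... | true  | _      | _      = refl
  ... | false | no _   | no _   = refl
  ... | false | yes pz | _      = ⊥-elim (away refl (inj₁ pz))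
  ... | false | no _   | yes qz = ⊥-elim (away refl (inj₂ qz))

  flipPartner-sound : ∀ es z {w} → flipPartner es z ≡ just w →
                      Σ (Node G × Node G) λ e → e ∈ es × NonM e × (e ≡ (z , w) ⊎ e ≡ (w , z))
  flipPartner-sound []             z ()
  flipPartner-sound ((p , q) ∷ es) z e with inM G M p q in pq | p ≟ₙ z | q ≟ₙ z
  flipPartner-sound ((p , q) ∷ es) z e    | true  | _       | _       with flipPartner-sound es z e
  ... | e′ , e′∈ , rest = e′ , there e′∈ , rest
  flipPartner-sound ((p , q) ∷ es) z refl | false | yes refl | _       = (p , q) , here refl , pq , inj₁ refl
  flipPartner-sound ((p , q) ∷ es) z refl | false | no _    | yes refl = (p , q) , here refl , pq , inj₂ refl
  flipPartner-sound ((p , q) ∷ es) z e    | false | no _    | no _    with flipPartner-sound es z e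
  ... | e′ , e′∈ , rest = e′ , there e′∈ , rest

  flipPartner-none : ∀ es z → (∀ {e} → e ∈ es → NonM e → ¬ Touches e z) → flipPartner es z ≡ nothing
  flipPartner-none []       z away = refl
  flipPartner-none (e ∷ es) z away = trans (flipPartner-skip e es z (away (here refl))) (flipPartner-none es z λ m → away (there m))

  record Flippable (es : List (Node G × Node G)) : Set where
    field
      edges : All (λ e → adj G (proj₁ e) (proj₂ e) ≡ true) es
      apart : AllPairs Apart es

  flipPartner-complete : ∀ {es} → Flippable es → ∀ {e} → e ∈ es → NonM e →
    flipPartner es (proj₁ e) ≡ just (proj₂ e) × flipPartner es (proj₂ e) ≡ just (proj₁ e)
  flipPartner-complete {(p , q) ∷ es} F (here refl) pq with inM G M p q | p ≟ₙ p | q ≟ₙ q | p ≟ₙ q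
  ... | false | no p≢p | _      | _      = ⊥-elim (p≢p refl)
  ... | false | yes _  | no q≢q | _      = ⊥-elim (q≢q refl)
  ... | false | yes _  | yes _  | yes refl = ⊥-elim (loop (All.head (Flippable.edges F)))
    where loop : adj G p p ≡ true → ⊥
          loop e with trans (sym (adj-irrefl p)) e
          ... | ()
  ... | false | yes _  | yes _  | no _   = refl , refl
  flipPartner-complete {e₀ ∷ es} F {e} (there e∈) ne with Flippable.apart F | Flippable.edges F
  ... | apart₀ ∷ apart | _ ∷ edges with flipPartner-complete record { edges = edges ; apart = apart } e∈ ne
  ...   | first , second = trans (flipPartner-skip e₀ es _ (away (inj₁ refl))) first ,
                          trans (flipPartner-skip e₀ es _ (away (inj₂ refl))) second
    where
      away : ∀ {z} → Touches e z → NonM e₀ → ¬ Touches e₀ z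
      away t ne₀ t₀ = All.lookup apart₀ e∈ ne₀ ne t₀ t

  flipMateFunction : ∀ es → Flippable es → MateFunction
  flipMateFunction es F = record
    { partnerOf  = flipPartner es
    ; symmetric  = symmetric
    ; alongEdges = alongEdges
    }
    where
      symmetric : ∀ {z w} → flipPartner es z ≡ just w → flipPartner es w ≡ just z
      symmetric {z} e with flipPartner-sound es z e
      ... | _ , e∈ , ne , inj₁ refl = proj₂ (flipPartner-complete F e∈ ne)
      ... | _ , e∈ , ne , inj₂ refl = proj₁ (flipPartner-complete F e∈ ne)
      alongEdges : ∀ {z w} → flipPartner es z ≡ just w → adj G z w ≡ true
      alongEdges {z} {w} e with flipPartner-sound es z e
      ... | _ , e∈ , _ , inj₁ refl = All.lookup (Flippable.edges F) e∈
      ... | _ , e∈ , _ , inj₂ refl = trans (adj-sym z w) (All.lookup (Flippable.edges F) e∈)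

  path-apart : ∀ L → Unique L → Alternates (labels (inM G M) L) → AllPairs Apart (pairs L)
  path-apart []              u a = []
  path-apart (x ∷ [])        u a = []
  path-apart (x ∷ y ∷ [])    u a = [] ∷ []
  path-apart (x ∷ y ∷ z ∷ r) u (xy≢yz ∷ a) = head-apart ∷ path-apart (y ∷ z ∷ r) (AllPairs.tail u) a
    where
      away : ∀ {w} → w ∈ z ∷ r → Touches (x , y) w → ⊥
      away w∈ (inj₁ refl) = Unique[x∷xs]⇒x∉xs u (there w∈)
      away w∈ (inj₂ refl) = Unique[x∷xs]⇒x∉xs (AllPairs.tail u) w∈
      head-apart : All (Apart (x , y)) (pairs (y ∷ z ∷ r))
      head-apart = All.tabulate λ
        { (here refl) nxy nyz _ _ → xy≢yz (trans nxy (sym nyz))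
        ; (there e′∈) _ _ t (inj₁ refl) → away (∈-pairs-proj₁ (z ∷ r) e′∈) t
        ; (there e′∈) _ _ t (inj₂ refl) → away (there (∈-pairs-proj₂ z r e′∈)) t
        }

  cycle-apart : ∀ x y z r → Unique (x ∷ y ∷ z ∷ r) → Alternates (closeUp (labels (inM G M) (closeUp (x ∷ y ∷ z ∷ r)))) →
                AllPairs Apart (pairs (closeUp (x ∷ y ∷ z ∷ r)))
  cycle-apart x y z r u alt = head-apart ∷ path-apart P (Unique-snoc (AllPairs.tail u) (Unique[x∷xs]⇒x∉xs u)) (Alternates-tail path-alt)
    where
      P = y ∷ z ∷ r ++ [ x ]
      closed = Alternates-snoc⁻ (inM G M x y) (labels (inM G M) P) alt
      path-alt = proj₁ closed
      uP : Unique P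
      uP = Unique-snoc (AllPairs.tail u) (Unique[x∷xs]⇒x∉xs u)
      head-apart : All (Apart (x , y)) (pairs P)
      head-apart = All.tabulate λ {e′} e′∈ nxy ne′ {w} t t′ → meets e′∈ nxy ne′ t t′
        where
          meets : ∀ {e′ w} → e′ ∈ pairs P → NonM (x , y) → NonM e′ → Touches (x , y) w → Touches e′ w → ⊥
          meets e′∈ nxy ne′ (inj₂ refl) t′ with pair-at-head uP e′∈ t′
          ... | refl with path-alt
          ...   | xy≢yz ∷ _ = xy≢yz (trans nxy (sym ne′))
          meets {e′} e′∈ nxy ne′ (inj₁ refl) t′ with pair-at-last uP e′∈ (Sum.map (λ e → trans e (sym (lastOf-snoc z r x)))
                                                                                 (λ e → trans e (sym (lastOf-snoc z r x))) t′)
          ... | refl = proj₂ closed (trans (lastOf-labels (inM G M) x y (z ∷ r ++ [ x ])) (trans ne′′ (sym nxy)))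
            where ne′′ : uncurry (inM G M) (lastPair y z (r ++ [ x ])) ≡ false
                  ne′′ = ne′

  OnMPair : List (Node G × Node G) → Node G → Set
  OnMPair es z = Σ (Node G × Node G) λ e → e ∈ es × inM G M (proj₁ e) (proj₂ e) ≡ true × Touches e z

  alternating-cover : ∀ x y r → Alternates (labels (inM G M) (x ∷ y ∷ r)) → ∀ {z} → z ∈ x ∷ y ∷ r →
    OnMPair (pairs (x ∷ y ∷ r)) z ⊎ (z ≡ x × inM G M x y ≡ false)
                                  ⊎ (z ≡ proj₂ (lastPair x y r) × uncurry (inM G M) (lastPair x y r) ≡ false)
  alternating-cover x y r a (here refl) with inM G M x y in xy
  ... | true  = inj₁ ((x , y) , here refl , xy , inj₁ refl)
  ... | false = inj₂ (inj₁ (refl , refl))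
  alternating-cover x y [] a (there (here refl)) with inM G M x y in xy
  ... | true  = inj₁ ((x , y) , here refl , xy , inj₂ refl)
  ... | false = inj₂ (inj₂ (refl , refl))
  alternating-cover x y (c ∷ r) (xy≢yc ∷ a) (there z∈) with alternating-cover y c r a z∈
  ... | inj₁ (e , e∈ , t , o)  = inj₁ (e , there e∈ , t , o)
  ... | inj₂ (inj₂ at-last)   = inj₂ (inj₂ at-last)
  ... | inj₂ (inj₁ (refl , yc)) with inM G M x y in xy
  ...   | true  = inj₁ ((x , y) , here refl , xy , inj₂ refl)
  ...   | false = ⊥-elim (xy≢yc (sym yc))

  OnMPair⇒mate : ∀ {es z} → OnMPair es z → Σ (Node G × Node G) λ e → e ∈ es × inM G M (proj₁ e) (proj₂ e) ≡ true ×
                   Σ (Node G) λ w → mate M z ≡ just w × Touches e w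
  OnMPair⇒mate ((p , q) , e∈ , pq , inj₁ refl) = (p , q) , e∈ , pq , q , inM⇒mate M p q pq , inj₂ refl
  OnMPair⇒mate ((p , q) , e∈ , pq , inj₂ refl) = (p , q) , e∈ , pq , p , mate-sym M {p} (inM⇒mate M p q pq) , inj₁ refl

  Touches⇒∈ : ∀ L {e w} → e ∈ pairs L → Touches e w → w ∈ L
  Touches⇒∈ L e∈ (inj₁ refl) = ∈-pairs-proj₁ L e∈
  Touches⇒∈ (x ∷ L) e∈ (inj₂ refl) = there (∈-pairs-proj₂ x L e∈)

  covered⇒closed : ∀ K es → (∀ {e w} → e ∈ es → Touches e w → w ∈ K) →
                   (∀ {z} → z ∈ K → OnMPair es z ⊎ mate M z ≡ nothing) → Closed M K
  covered⇒closed K es within cover {z} z∈ e with cover z∈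
  ... | inj₂ free with trans (sym e) free
  ...   | ()
  covered⇒closed K es within cover {z} z∈ e | inj₁ on with OnMPair⇒mate on
  ... | _ , e′∈ , _ , w , mate-z , t with trans (sym e) mate-z
  ...   | refl = within e′∈ t

  module FlipAlong (L : List (Node G)) (es : List (Node G × Node G)) (F : Flippable es)
                   (within : ∀ {e w} → e ∈ es → Touches e w → w ∈ L) (closedM : Closed M L) where

    private
      flips : Matching G
      flips = fromMateFunction (flipMateFunction es F)

      closed-flips : Closed flips L
      closed-flips {z} z∈ e with flipPartner-sound es z (trans (sym (mate-fromMateFunction (flipMateFunction es F) z)) e)
      ... | _ , e∈ , _ , inj₁ refl = within e∈ (inj₂ refl)
      ... | _ , e∈ , _ , inj₂ refl = within e∈ (inj₁ refl)

    open Splice flips M L closed-flips closedM public using ()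
      renaming (splice to flipped; mate-splice-∉ to flipped-off)

    flipped-on : ∀ {z} → z ∈ L → mate flipped z ≡ flipPartner es z
    flipped-on {z} z∈ = trans (Splice.mate-splice-∈ flips M L closed-flips closedM z∈) (mate-fromMateFunction (flipMateFunction es F) z)

    flipped-switches : (∀ {e} → e ∈ es → proj₁ e ∈ L) → All (Switching.SwitchedEdge G M flipped) es
    flipped-switches fst∈ = All.tabulate λ e∈ →
      All.lookup (Flippable.edges F) e∈ , λ ne → trans (flipped-on (fst∈ e∈)) (proj₁ (flipPartner-complete F e∈ ne))

  head-untouched : ∀ {x y r} → Unique (x ∷ y ∷ r) → inM G M x y ≡ true →
                   ∀ {e} → e ∈ pairs (x ∷ y ∷ r) → NonM e → ¬ Touches e x
  head-untouched u xy e∈ ne t with pair-at-head u e∈ t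
  ... | refl with trans (sym ne) xy
  ...   | ()

  last-untouched : ∀ {x y r} → Unique (x ∷ y ∷ r) → uncurry (inM G M) (lastPair x y r) ≡ true →
                   ∀ {e} → e ∈ pairs (x ∷ y ∷ r) → NonM e → ¬ Touches e (proj₂ (lastPair x y r))
  last-untouched {x} {y} {r} u pq e∈ ne t
    with pair-at-last u e∈ (Sum.map (λ e → trans e (proj₂-lastPair x y r)) (λ e → trans e (proj₂-lastPair x y r)) t)
  ... | refl with trans (sym ne) pq
  ...   | ()

  record FlippablePath (x y : Node G) (r : List (Node G)) : Set where
    field
      distinct   : Unique (x ∷ y ∷ r)
      alternates : Alternates (labels (inM G M) (x ∷ y ∷ r))
      edges      : All (λ e → adj G (proj₁ e) (proj₂ e) ≡ true) (pairs (x ∷ y ∷ r))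
      headFree   : inM G M x y ≡ false → mate M x ≡ nothing
      lastFree   : uncurry (inM G M) (lastPair x y r) ≡ false → mate M (proj₂ (lastPair x y r)) ≡ nothing

  flip-path : ∀ {x y r} → FlippablePath x y r → Σ (Matching G) λ N → Switching.SwitchedPath G M N x y r
  flip-path {x} {y} {r} P = flipped , record
    { distinct   = distinct
    ; alternates = alternates
    ; edges      = flipped-switches (∈-pairs-proj₁ L)
    ; agreeOff   = λ _ → flipped-off
    ; headEnd    = head-end
    ; lastEnd    = last-end
    }
    where
      open FlippablePath P
      L = x ∷ y ∷ r
      F : Flippable (pairs L)
      F = record { edges = edges ; apart = path-apart L distinct alternates }
      cover : ∀ {z} → z ∈ L → OnMPair (pairs L) z ⊎ mate M z ≡ nothing
      cover z∈ with alternating-cover x y r alternates z∈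
      ... | inj₁ on                = inj₁ on
      ... | inj₂ (inj₁ (refl , f)) = inj₂ (headFree f)
      ... | inj₂ (inj₂ (refl , f)) = inj₂ (lastFree f)
      open FlipAlong L (pairs L) F (Touches⇒∈ L) (covered⇒closed L (pairs L) (Touches⇒∈ L) cover)
      open Switching G M flipped using (SwitchedEnd)
      head-end : SwitchedEnd (inM G M x y) x
      head-end = by-label (inM G M x y) refl
        where
          by-label : ∀ b → inM G M x y ≡ b → SwitchedEnd b x
          by-label false xy = headFree xy
          by-label true  xy = trans (flipped-on (here refl)) (flipPartner-none (pairs L) x (head-untouched distinct xy))
      last-end : SwitchedEnd (uncurry (inM G M) (lastPair x y r)) (proj₂ (lastPair x y r))
      last-end = by-label (uncurry (inM G M) (lastPair x y r)) refl
        where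
          by-label : ∀ b → uncurry (inM G M) (lastPair x y r) ≡ b → SwitchedEnd b (proj₂ (lastPair x y r))
          by-label false pq = lastFree pq
          by-label true  pq = trans (flipped-on (Touches⇒∈ L (lastPair-∈ x y r) (inj₂ refl)))
                                    (flipPartner-none (pairs L) _ (last-untouched distinct pq))

  flip-cycle : ∀ {x y z r} → IsAltCycle G M (x ∷ y ∷ z ∷ r) → Σ (Matching G) λ N → Switching.SwitchedCycle G M N x y (z ∷ r)
  flip-cycle {x} {y} {z} {r} C = flipped , record
    { distinct   = distinct
    ; alternates = alternates
    ; edges      = flipped-switches λ e∈ → ∈-closeUp⁻ K (∈-pairs-proj₁ (closeUp K) e∈)
    ; agreeOff   = λ _ → flipped-off
    }
    where
      open IsAltCycle C
      K = x ∷ y ∷ z ∷ r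
      F : Flippable (pairs (closeUp K))
      F = record { edges = edges ; apart = cycle-apart x y z r distinct alternates }
      within : ∀ {e w} → e ∈ pairs (closeUp K) → Touches e w → w ∈ K
      within e∈ t = ∈-closeUp⁻ K (Touches⇒∈ (closeUp K) e∈ t)
      closed = Alternates-snoc⁻ (inM G M x y) (labels (inM G M) (y ∷ z ∷ r ++ [ x ])) alternates
      last-pair = lastPair x y (z ∷ r ++ [ x ])
      last-label : uncurry (inM G M) last-pair ≢ inM G M x y
      last-label = subst (_≢ inM G M x y) (lastOf-labels (inM G M) x y (z ∷ r ++ [ x ])) (proj₂ closed)
      last-node : proj₂ last-pair ≡ x
      last-node = trans (proj₂-lastPair x y (z ∷ r ++ [ x ])) (lastOf-snoc z r x)
      -- every node of a cycle lies on one of its M-pairs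
      cover : ∀ {v} → v ∈ K → OnMPair (pairs (closeUp K)) v ⊎ mate M v ≡ nothing
      cover v∈ with alternating-cover x y (z ∷ r ++ [ x ]) (proj₁ closed) (∈-closeUp⁺ K v∈)
      ... | inj₁ on                 = inj₁ on
      ... | inj₂ (inj₁ (refl , xy)) =
              inj₁ (last-pair , lastPair-∈ x y (z ∷ r ++ [ x ]) , BoolP.¬-not (λ e → last-label (trans e (sym xy))) , inj₂ last-node)
      ... | inj₂ (inj₂ (refl , l))  =
              inj₁ ((x , y) , here refl , BoolP.¬-not (λ e → last-label (trans l (sym e))) , inj₁ (sym last-node))
      open FlipAlong K (pairs (closeUp K)) F within (covered⇒closed K (pairs (closeUp K)) within cover)

-- Parity of weights

Even : ℤ → Set
Even i = ∃ λ k → i ≡ k + k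

Even-sumℤ : ∀ xs → All Even xs → Even (sumℤ xs)
Even-sumℤ []       []              = 0ℤ , refl
Even-sumℤ (x ∷ xs) ((k , x≡) ∷ es) with Even-sumℤ xs es
... | j , s≡ = k + j , trans (cong₂ _+_ x≡ s≡) (solve 2 (λ k j → (k :+ k) :+ (j :+ j) := (k :+ j) :+ (k :+ j)) refl k j)

-- a positive even number is at least 2
Even-pos⇒pos-1 : ∀ {i} → Even i → 0ℤ < i → 0ℤ < i - 1ℤ
Even-pos⇒pos-1 (+ zero  , refl) pos = ⊥-elim (ℤP.<-irrefl refl pos)
Even-pos⇒pos-1 (+ suc n , refl) _   = ℤ.+<+ (subst (0 ℕ.<_) (sym (ℕP.+-suc n n)) (ℕ.s≤s ℕ.z≤n))
Even-pos⇒pos-1 (-[1+ n ] , refl) ()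

wt-even : (G : Instance) (M : Matching G) (x y : Node G) → Even (wt G M x y)
wt-even G M (inj₁ a) (inj₂ b)  = weights
  (pref (rankA a) (just b) (mateA M a) ∧ pref (rankB b) (just a) (mateB M b))
  (pref (rankA a) (mateA M a) (just b) ∧ pref (rankB b) (mateB M b) (just a))
  where
    open Instance G
    weights : ∀ c₁ c₂ → Even (if c₁ then + 2 else if c₂ then - (+ 2) else 0ℤ)
    weights true  _     = 1ℤ , refl
    weights false true  = -[1+ 0 ] , refl
    weights false false = 0ℤ , refl
wt-even G M (inj₂ b) (inj₁ a)  = wt-even G M (inj₁ a) (inj₂ b)
wt-even G M (inj₁ a) (inj₁ a′) = 0ℤ , refl
wt-even G M (inj₂ b) (inj₂ b′) = 0ℤ , refl

wtPath-even : (G : Instance) (M : Matching G) (L : List (Node G)) → Even (wtPath G M L)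
wtPath-even G M L = Even-sumℤ _ (All.tabulate λ m → even-term (∈-map⁻ (uncurry (wt G M)) m))
  where
    even-term : ∀ {i} → ∃ (λ e → e ∈ pairs L × i ≡ uncurry (wt G M) e) → Even i
    even-term ((p , q) , _ , refl) = wt-even G M p q

wtPath-snoc : (G : Instance) (M : Matching G) (x : Node G) (xs : List (Node G)) (w : Node G) →
              wtPath G M (x ∷ xs ++ [ w ]) ≡ wtPath G M (x ∷ xs) + wt G M (lastOf x xs) w
wtPath-snoc G M x xs w = begin
  sumℤ (map f (pairs (x ∷ xs ++ [ w ])))               ≡⟨ cong (λ ps → sumℤ (map f ps)) (pairs-snoc x xs w) ⟩
  sumℤ (map f (pairs (x ∷ xs) ++ [ (lastOf x xs , w) ])) ≡⟨ sumℤ-map f (pairs (x ∷ xs) ++ [ (lastOf x xs , w) ]) ⟩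
  ∑ (pairs (x ∷ xs) ++ [ (lastOf x xs , w) ]) f         ≡⟨ ∑-++ (pairs (x ∷ xs)) [ (lastOf x xs , w) ] f ⟩
  ∑ (pairs (x ∷ xs)) f + (f (lastOf x xs , w) + 0ℤ)     ≡⟨ cong₂ _+_ (sym (sumℤ-map f (pairs (x ∷ xs)))) (ℤP.+-identityʳ _) ⟩
  sumℤ (map f (pairs (x ∷ xs))) + f (lastOf x xs , w)   ∎
  where
    open ≡-Reasoning
    f = uncurry (wt G M)

module Extending (G : Instance) (M : Matching G) where
  open Matchings G
  open Flipping G M

  private
    nothing≢just : ∀ {v : Node G} → nothing ≢ just v
    nothing≢just ()

    free⇒unmatched-edge : ∀ x y → mate M x ≡ nothing → inM G M x y ≡ false
    free⇒unmatched-edge x y free with inM G M x y in xy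
    ... | false = refl
    ... | true  = ⊥-elim (nothing≢just (trans (sym free) (inM⇒mate M x y xy)))

  last-mate-∉ : ∀ {x y r w} → Unique (x ∷ y ∷ r) → Alternates (labels (inM G M) (x ∷ y ∷ r)) → mate M x ≡ nothing →
                uncurry (inM G M) (lastPair x y r) ≡ false → mate M (lastOf y r) ≡ just w → w ∉ x ∷ y ∷ r
  last-mate-∉ {x} {y} {r} u a free-x l mz w∈ with alternating-cover x y r a w∈
  ... | inj₂ (inj₁ (refl , _)) = nothing≢just (trans (sym free-x) (mate-sym M {lastOf y r} mz))
  ... | inj₂ (inj₂ (refl , _)) = mate-irrefl M (lastOf y r) (trans mz (cong just (proj₂-lastPair x y r)))
  ... | inj₁ on with OnMPair⇒mate on
  ...   | e , e∈ , eM , o , mw , t with MaybeP.just-injective (trans (sym (mate-sym M {lastOf y r} mz)) mw)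
  ...     | refl with pair-at-last u e∈ t
  ...       | refl with trans (sym eM) l
  ...         | ()

  head-mate-∉ : ∀ {x y r w} → Unique (x ∷ y ∷ r) → Alternates (labels (inM G M) (x ∷ y ∷ r)) → mate M (lastOf y r) ≡ nothing →
                inM G M x y ≡ false → mate M x ≡ just w → w ∉ x ∷ y ∷ r
  head-mate-∉ {x} {y} {r} u a free-z xy mx w∈ with alternating-cover x y r a w∈
  ... | inj₂ (inj₁ (refl , _)) = mate-irrefl M x mx
  ... | inj₂ (inj₂ (refl , _)) =
          nothing≢just (trans (sym free-z) (trans (cong (mate M) (sym (proj₂-lastPair x y r))) (mate-sym M {x} mx)))
  ... | inj₁ on with OnMPair⇒mate on
  ...   | e , e∈ , eM , o , mw , t with MaybeP.just-injective (trans (sym (mate-sym M {x} mx)) mw)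
  ...     | refl with pair-at-head u e∈ t
  ...       | refl with trans (sym eM) xy
  ...         | ()

  extend-last : ∀ {x y r w} → IsAltPath G M (x ∷ y ∷ r) → mate M x ≡ nothing →
                uncurry (inM G M) (lastPair x y r) ≡ false → mate M (lastOf y r) ≡ just w →
                FlippablePath x y (r ++ [ w ]) × wtPath G M (x ∷ y ∷ r ++ [ w ]) ≡ wtPath G M (x ∷ y ∷ r)
  extend-last {x} {y} {r} {w} P free-x l mz = record
    { distinct   = Unique-snoc distinct (last-mate-∉ distinct alternates free-x l mz)
    ; alternates = subst Alternates (sym (labels-snoc (inM G M) x (y ∷ r) w))
                     (Alternates-snoc⁺ (inM G M x y) (labels (inM G M) (y ∷ r)) alternates
                       λ e → false≢true (trans (sym l) (trans (sym (lastOf-labels (inM G M) x y r)) (trans e zw))))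
    ; edges      = subst (All _) (sym (pairs-snoc x (y ∷ r) w)) (AllP.++⁺ edges (mate-adj M {lastOf y r} mz ∷ []))
    ; headFree   = λ _ → free-x
    ; lastFree   = λ l′ → ⊥-elim (false≢true (trans (sym l′) (trans (cong (uncurry (inM G M)) (lastPair-snoc x y r w)) zw)))
    } , trans (wtPath-snoc G M x (y ∷ r) w)
              (trans (cong (_+_ (wtPath G M (x ∷ y ∷ r))) (wt-matched-edge M (lastOf y r) w zw)) (ℤP.+-identityʳ _))
    where
      open IsAltPath P
      false≢true : false ≢ true
      false≢true ()
      zw : inM G M (lastOf y r) w ≡ true
      zw = mate⇒inM M (lastOf y r) w mz

  extend-first : ∀ {x y r w} → IsAltPath G M (x ∷ y ∷ r) → mate M (lastOf y r) ≡ nothing →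
                 inM G M x y ≡ false → mate M x ≡ just w →
                 FlippablePath w x (y ∷ r) × wtPath G M (w ∷ x ∷ y ∷ r) ≡ wtPath G M (x ∷ y ∷ r)
  extend-first {x} {y} {r} {w} P free-z xy mx = record
    { distinct   = ∉⇒Unique∷ (head-mate-∉ distinct alternates free-z xy mx) distinct
    ; alternates = (λ e → true≢false (trans (sym wx) (trans e xy))) ∷ alternates
    ; edges      = mate-adj M {w} (mate-sym M {x} mx) ∷ edges
    ; headFree   = λ f → ⊥-elim (true≢false (trans (sym wx) f))
    ; lastFree   = λ _ → trans (cong (mate M) (proj₂-lastPair x y r)) free-z
    } , trans (cong (_+ wtPath G M (x ∷ y ∷ r)) (wt-matched-edge M w x wx)) (ℤP.+-identityˡ _)
    where
      open IsAltPath P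
      true≢false : true ≢ false
      true≢false ()
      wx : inM G M w x ≡ true
      wx = mate⇒inM M w x (mate-sym M {x} mx)

  record FlippableForm (p : List (Node G)) : Set where
    field
      x y        : Node G
      r          : List (Node G)
      flippable  : FlippablePath x y r
      freeEnd    : inM G M x y ≡ false ⊎ uncurry (inM G M) (lastPair x y r) ≡ false
      sameWeight : wtPath G M (x ∷ y ∷ r) ≡ wtPath G M p

  private
    true≢false : true ≢ false
    true≢false ()

    last-free⇒unmatched-edge : ∀ {x y r} → mate M (lastOf y r) ≡ nothing → uncurry (inM G M) (lastPair x y r) ≡ false
    last-free⇒unmatched-edge {x} {y} {r} free-z =
      trans (inM-sym M (proj₁ (lastPair x y r)) (proj₂ (lastPair x y r)))
            (free⇒unmatched-edge (proj₂ (lastPair x y r)) (proj₁ (lastPair x y r)) (trans (cong (mate M) (proj₂-lastPair x y r)) free-z))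

    as-is : ∀ {x y r} → IsAltPath G M (x ∷ y ∷ r) → (inM G M x y ≡ false → mate M x ≡ nothing) →
            (uncurry (inM G M) (lastPair x y r) ≡ false → mate M (proj₂ (lastPair x y r)) ≡ nothing) →
            inM G M x y ≡ false ⊎ uncurry (inM G M) (lastPair x y r) ≡ false → FlippableForm (x ∷ y ∷ r)
    as-is {x} {y} {r} P head-free last-free free-end = record
      { x = x ; y = y ; r = r ; freeEnd = free-end ; sameWeight = refl
      ; flippable = record { distinct = distinct ; alternates = alternates ; edges = edges
                           ; headFree = head-free ; lastFree = last-free } }
      where open IsAltPath P

  from-free-head : ∀ {x y r} → IsAltPath G M (x ∷ y ∷ r) → mate M x ≡ nothing → FlippableForm (x ∷ y ∷ r)
  from-free-head {x} {y} {r} P free-x = by-last-label (uncurry (inM G M) (lastPair x y r)) refl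
    where
      free-end : inM G M x y ≡ false ⊎ uncurry (inM G M) (lastPair x y r) ≡ false
      free-end = inj₁ (free⇒unmatched-edge x y free-x)
      by-last-label : ∀ b → uncurry (inM G M) (lastPair x y r) ≡ b → FlippableForm (x ∷ y ∷ r)
      by-last-label true  l = as-is P (λ _ → free-x) (λ l′ → ⊥-elim (true≢false (trans (sym l) l′))) free-end
      by-last-label false l = by-last-mate (mate M (lastOf y r)) refl
        where
          by-last-mate : ∀ v → mate M (lastOf y r) ≡ v → FlippableForm (x ∷ y ∷ r)
          by-last-mate nothing  free-z = as-is P (λ _ → free-x) (λ _ → trans (cong (mate M) (proj₂-lastPair x y r)) free-z) free-end
          by-last-mate (just w) mz     = record
            { x = x ; y = y ; r = r ++ [ w ] ; flippable = proj₁ extended ; sameWeight = proj₂ extended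
            ; freeEnd = inj₁ (free⇒unmatched-edge x y free-x) }
            where extended = extend-last P free-x l mz

  from-free-last : ∀ {x y r} → IsAltPath G M (x ∷ y ∷ r) → mate M (lastOf y r) ≡ nothing → FlippableForm (x ∷ y ∷ r)
  from-free-last {x} {y} {r} P free-z = by-head-label (inM G M x y) refl
    where
      free-end : inM G M x y ≡ false ⊎ uncurry (inM G M) (lastPair x y r) ≡ false
      free-end = inj₂ (last-free⇒unmatched-edge {x} {y} {r} free-z)
      last-free : uncurry (inM G M) (lastPair x y r) ≡ false → mate M (proj₂ (lastPair x y r)) ≡ nothing
      last-free _ = trans (cong (mate M) (proj₂-lastPair x y r)) free-z
      by-head-label : ∀ b → inM G M x y ≡ b → FlippableForm (x ∷ y ∷ r)
      by-head-label true  xy = as-is P (λ f → ⊥-elim (true≢false (trans (sym xy) f))) last-free free-end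
      by-head-label false xy = by-head-mate (mate M x) refl
        where
          by-head-mate : ∀ v → mate M x ≡ v → FlippableForm (x ∷ y ∷ r)
          by-head-mate nothing  free-x = as-is P (λ _ → free-x) last-free free-end
          by-head-mate (just w) mx     = record
            { x = w ; y = x ; r = y ∷ r ; flippable = proj₁ extended ; sameWeight = proj₂ extended
            ; freeEnd = inj₂ (last-free⇒unmatched-edge {x} {y} {r} free-z) }
            where extended = extend-first P free-z xy mx

  flippable-form : ∀ p → IsAltPath G M p → HasUnmatchedEnd G M p → FlippableForm p
  flippable-form []          P _ with IsAltPath.nonTrivial P
  ... | ()
  flippable-form (_ ∷ [])    P _ with IsAltPath.nonTrivial P
  ... | ℕ.s≤s ()
  flippable-form (x ∷ y ∷ r) P (u , inj₁ refl , u-unmatched)   = from-free-head P (unmatched⇒mate≡nothing M x u-unmatched)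
  flippable-form (x ∷ y ∷ r) P (u , inj₂ at-last , u-unmatched) =
    from-free-last P (subst (λ v → mate M v ≡ nothing)
                            (trans (MaybeP.just-injective (trans (sym at-last) (last-lastPair x y r))) (proj₂-lastPair x y r))
                            (unmatched⇒mate≡nothing M u u-unmatched))

module Necessity (G : Instance) (M : Matching G) (maxM : IsMaximum G M)
  (popular : ∀ (N : Matching G) → IsMaximum G N → φ G N M ℕ.≤ φ G M N) where
  open Matchings G
  open Flipping G M
  open Extending G M

  private
    Δ≤0 : ∀ N → IsMaximum G N → Δ N M ≤ 0ℤ
    Δ≤0 N maxN = ℤP.i≤j⇒i-j≤0 (ℤ.+≤+ (popular N maxN))

    same-size⇒maximum : ∀ N → + size G N - + size G M ≡ 0ℤ → IsMaximum G N
    same-size⇒maximum N e X = subst (size G X ℕ.≤_) (sym (ℤP.+-injective (ℤP.i-j≡0⇒i≡j _ _ e))) (maxM X)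

    positive-Δ : ∀ N → + size G N - + size G M ≡ 0ℤ → ¬ (0ℤ < Δ N M)
    positive-Δ N same pos = ℤP.<-irrefl refl (ℤP.<-≤-trans pos (Δ≤0 N (same-size⇒maximum N same)))

  no-positive-cycle : ∀ (C : List (Node G)) → IsAltCycle G M C → ¬ (0ℤ < wtCycle G M C)
  no-positive-cycle (x ∷ y ∷ z ∷ r) C pos with flip-cycle C
  ... | N , S = positive-Δ N (size-switched-cycle S) (subst (0ℤ <_) (sym (Δ-switched-cycle S)) pos)
    where open Switching G M N
  no-positive-cycle []            C _ with IsAltCycle.nonTrivial C
  ... | ()
  no-positive-cycle (_ ∷ [])     C _ with IsAltCycle.nonTrivial C
  ... | ℕ.s≤s ()
  no-positive-cycle (_ ∷ _ ∷ []) C _ with IsAltCycle.nonTrivial C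
  ... | ℕ.s≤s (ℕ.s≤s ())

  flippable-nonpositive : ∀ {x y r} → FlippablePath x y r → inM G M x y ≡ false ⊎ uncurry (inM G M) (lastPair x y r) ≡ false →
                          ¬ (0ℤ < wtPath G M (x ∷ y ∷ r))
  flippable-nonpositive {x} {y} {r} P free-end pos with flip-path P
  ... | N , S = by-labels (inM G M x y) refl (uncurry (inM G M) (lastPair x y r)) refl free-end
    where
      open Switching G M N
      W = wtPath G M (x ∷ y ∷ r)
      W-1>0 = Even-pos⇒pos-1 (wtPath-even G M (x ∷ y ∷ r)) pos
      size-by : ∀ {a b} → inM G M x y ≡ a → uncurry (inM G M) (lastPair x y r) ≡ b →
                + size G N - + size G M ≡ (⟦ not a ⟧ + ⟦ not b ⟧) - 1ℤ
      size-by refl refl = size-switched-path S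
      Δ-by : ∀ {a b} → inM G M x y ≡ a → uncurry (inM G M) (lastPair x y r) ≡ b → Δ N M ≡ (W - ⟦ a ⟧) - ⟦ b ⟧
      Δ-by refl refl = Δ-switched-path S
      by-labels : ∀ a → inM G M x y ≡ a → ∀ b → uncurry (inM G M) (lastPair x y r) ≡ b → a ≡ false ⊎ b ≡ false → ⊥
      by-labels true  _  true  _  (inj₁ ())
      by-labels true  _  true  _  (inj₂ ())
      by-labels false ea false eb _ =
        ℤP.<-irrefl refl (ℤP.<-≤-trans (subst (0ℤ <_) (sym (size-by ea eb)) (ℤ.+<+ (ℕ.s≤s ℕ.z≤n)))
                                       (ℤP.i≤j⇒i-j≤0 (ℤ.+≤+ (maxM N))))
      by-labels false ea true  eb _ =
        positive-Δ N (size-by ea eb) (subst (0ℤ <_) (sym (trans (Δ-by ea eb) (cong (_- 1ℤ) (ℤP.+-identityʳ W)))) W-1>0)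
      by-labels true  ea false eb _ =
        positive-Δ N (size-by ea eb) (subst (0ℤ <_) (sym (trans (Δ-by ea eb) (ℤP.+-identityʳ (W - 1ℤ)))) W-1>0)

  no-positive-path : ∀ (p : List (Node G)) → IsAltPath G M p → HasUnmatchedEnd G M p → ¬ (0ℤ < wtPath G M p)
  no-positive-path p P free pos = flippable-nonpositive flippable freeEnd (subst (0ℤ <_) (sym sameWeight) pos)
    where open FlippableForm (flippable-form p P free)

theorem2 : (G : Instance) (M : Matching G) → IsMaximum G M →
    (IsPopularMaxMatching G M ⇔
      ((∀ (C : List (Node G)) → IsAltCycle G M C → ¬ (0ℤ < wtCycle G M C))
       × (∀ (p : List (Node G)) → IsAltPath G M p → HasUnmatchedEnd G M p →
            ¬ (0ℤ < wtPath G M p))))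
theorem2 G M maxM = mk⇔
  (λ (_ , popular) → Necessity.no-positive-cycle G M maxM popular , Necessity.no-positive-path G M maxM popular)
  (λ (no-cycle , no-path) → Sufficiency.popular G M maxM no-cycle no-path)
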